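{- Let $q$ and $n$ be two coprime positive integers. Let $\mathcal{N}$ be the set of necklaces of length $n$ whose beads are colored from a set of $q$ colors, and let $\mathcal{F}$ be the set of functions $f:\mathbb{Z}_n\to\{0,1,\ldots,q-1\}$ such that $\sum_{z\in\mathbb{Z}_n} z\,f(z)\equiv 0 \pmod n$. Then \[ |\mathcal{N}|=|\mathcal{F}|=\sum_{I\subseteq\{1,\ldots,m\}} \frac{\gcd\big(n,\gcd(s_i)_{i\in I}\big)}{n}\,\prod_{i\in I}\big(q^{\ell_i}-1\big), \] where $m$, $s_i$, $\ell_i$ are as described in the context.
   Context: A necklace of length $n$ with $q$ colors is an equivalence class of words of length $n$ over a $q$-letter alphabet under cyclic rotation. $\mathbb{Z}_n$ denotes the integers modulo $n$. Consider the equivalence relation on $\mathbb{Z}_n$ generated by $z\sim qz$ (i.e. $z\sim q^jz$ for all $j\ge 0$). Let $s_1,\ldots,s_m$ be integers representing the $m$ equivalence classes; the class of $s_i$ is the cyclotomic coset $S_i=\{s_i,qs_i,\ldots,q^{\ell_i-1}s_i\}$, where $\ell_i$ is the smallest positive integer with $q^{\ell_i}s_i\equiv s_i\pmod n$. For $I=\emptyset$, $\gcd(n,\gcd(s_i)_{i\in I})$ is interpreted as $n$ (the empty product is $1$). -}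

module Defs where

open import Data.Nat using (ℕ; zero; suc; _+_; _*_; _∸_; _^_; _≤_; _<_; NonZero)
open import Data.Nat.DivMod using (_%_; m%n<n)
open import Data.Nat.GCD using (gcd)
open import Data.Fin using (Fin; toℕ; fromℕ<)
open import Data.Vec using (Vec; lookup; tabulate; sum; []; _∷_)
open import Data.Fin.Subset using (Subset; inside; outside)
open import Data.Bool using (true; false)
open import Data.Product using (Σ; ∃; ∃₂; _×_; _,_)
open import Function using (_∘_)
open import Relation.Binary.PropositionalEquality using (_≡_)

Word : ℕ → ℕ → Set
Word n q = Vec (Fin q) n

rotIdx : (n : ℕ) .{{_ : NonZero n}} → ℕ → Fin n → Fin n
rotIdx n k i = fromℕ< (m%n<n (toℕ i + k) n)

RotEquiv : (n q : ℕ) .{{_ : NonZero n}} → Word n q → Word n q → Set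
RotEquiv n q v w = ∃ λ (k : ℕ) → ∀ (i : Fin n) → lookup w i ≡ lookup v (rotIdx n k i)

-- "There are exactly k necklaces": there is a complete system of k
-- pairwise non-equivalent representatives of the rotation classes.
IsNecklaceCount : (n q : ℕ) .{{_ : NonZero n}} → ℕ → Set
IsNecklaceCount n q k =
  Σ (Fin k → Word n q) λ reps →
    (∀ (a b : Fin k) → RotEquiv n q (reps a) (reps b) → a ≡ b)
    × (∀ (w : Word n q) → ∃ λ (a : Fin k) → RotEquiv n q (reps a) w)

weight : (n q : ℕ) → Word n q → ℕ
weight n q f = sum (tabulate {n = n} λ z → toℕ z * toℕ (lookup f z))

FSet : (n q : ℕ) .{{_ : NonZero n}} → Set
FSet n q = Σ (Word n q) λ f → weight n q f % n ≡ 0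

-- s : Fin m → ℤ_n is a system of representatives of the classes of
-- the relation z ∼ q^j z on ℤ_n (one per class).
CosetReps : (n q m : ℕ) .{{_ : NonZero n}} → (Fin m → Fin n) → Set
CosetReps n q m s =
  (∀ (a b : Fin m) (j : ℕ) → toℕ (s b) ≡ (q ^ j * toℕ (s a)) % n → a ≡ b)
  × (∀ (z : Fin n) → ∃₂ λ (a : Fin m) (j : ℕ) → toℕ z ≡ (q ^ j * toℕ (s a)) % n)

IsCosetLength : (n q s ℓ : ℕ) .{{_ : NonZero n}} → Set
IsCosetLength n q s ℓ =
  0 < ℓ × (q ^ ℓ * s) % n ≡ s % n
  × (∀ (l : ℕ) → 0 < l → (q ^ l * s) % n ≡ s % n → ℓ ≤ l)

sumSubsets : (m : ℕ) → (Subset m → ℕ) → ℕ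
sumSubsets zero    f = f []
sumSubsets (suc m) f = sumSubsets m (f ∘ (outside ∷_)) + sumSubsets m (f ∘ (inside ∷_))

-- gcd(n, gcd(s_i)_{i∈I}); equals n for I = ∅
gcdSub : ℕ → (m : ℕ) → (Fin m → ℕ) → Subset m → ℕ
gcdSub n zero    s []            = n
gcdSub n (suc m) s (false ∷ I)   = gcdSub n m (s ∘ Fin.suc) I
gcdSub n (suc m) s (true  ∷ I)   = gcd (s Fin.zero) (gcdSub n m (s ∘ Fin.suc) I)

prodSub : (m : ℕ) → (Fin m → ℕ) → Subset m → ℕ
prodSub zero    g []          = 1
prodSub (suc m) g (false ∷ I) = prodSub m (g ∘ Fin.suc) I
prodSub (suc m) g (true  ∷ I) = g Fin.zero * prodSub m (g ∘ Fin.suc) I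

-- n times the right-hand side:
-- Σ_{I ⊆ {1..m}} gcd(n, gcd(s_i)_{i∈I}) · ∏_{i∈I} (q^{ℓ_i} − 1)
nTimesRHS : (n q m : ℕ) → (Fin m → Fin n) → (Fin m → ℕ) → ℕ
nTimesRHS n q m s ℓ =
  sumSubsets m λ I → gcdSub n m (toℕ ∘ s) I * prodSub m (λ i → q ^ ℓ i ∸ 1) I

module Submission where

-- Necklaces: by Burnside's lemma for rotations (necklaces being represented by
-- their rotation of least code), n·|𝓝| = Σ_{t<n} q^{gcd(t,n)}, since the words
-- fixed by rotation by t are those of period gcd(t,n).
-- Right-hand side: writing gcd(n, gcd(s_i)_{i∈I}) = #{t < n : n ∣ t·gcd(…)} and
-- expanding Σ_I ∏_{i∈I} = ∏_i (1 + ·), n·RHS = Σ_t q^{#{z : n ∣ tz}} = Σ_t q^{gcd(t,n)},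
-- because the cyclotomic cosets partition ℤ_n.
-- 𝓕: reading f coset by coset, Σ z f(z) becomes Σ_i s_i·(base-q value of the
-- i-th block), and induction on the number of cosets, counting solutions of a
-- linear congruence at each step, gives n·|𝓕| = n·RHS directly.

open import Defs
open import Data.Nat using (ℕ; _*_; _<_; NonZero)
open import Data.Nat.Coprimality using (Coprime)
open import Data.Fin using (Fin; toℕ)
open import Data.Product using (∃; _×_)
open import Function.Bundles using (_↔_)
open import Relation.Binary.PropositionalEquality using (_≡_)

open import Axiom.UniquenessOfIdentityProofs.WithK using (uip)
open import Data.Nat
  using (zero; suc; pred; _+_; _∸_; _^_; _≤_; _⊓_; _≟_; z≤n; s≤s; s≤s⁻¹; >-nonZero; >-nonZero⁻¹; ≢-nonZero)
open import Data.Nat.Properties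
open import Data.Nat.DivMod using (_%_; _/_; m%n<n; m%n%n≡m%n; m≡m%n+[m/n]*n; [m+kn]%n≡m%n; m<n⇒m%n≡m;
  %-distribˡ-+; %-distribˡ-*; n%n≡0; %-remove-+ʳ; m∣n⇒o%n%m≡o%m; m%n≤n; m/n*n≡m)
open import Data.Nat.Divisibility
open import Data.Nat.GCD using (gcd; gcd[m,n]∣m; gcd[m,n]∣n; gcd[m,n]≢0; gcd-greatest; gcd[m,n]≤n;
  c*gcd[m,n]≡gcd[cm,cn]; gcd-GCD; module Bézout)
open import Data.Nat.Coprimality using (coprime-divisor; coprime-Bézout; coprime-/gcd)
import Data.Nat.Coprimality as Coprime
open import Data.Nat.Solver using (module +-*-Solver)
open import Data.Fin using (zero; suc; fromℕ<; _↑ˡ_; _↑ʳ_; splitAt; join; combine; remQuot)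
import Data.Fin.Properties as Fin
open import Data.Fin.Permutation using (↔⇒≡)
open import Data.Fin.Subset using (Subset; inside; outside)
open import Data.Bool using (true; false)
open import Data.Product using (Σ; ∃₂; _,_; proj₁; proj₂)
open import Data.Sum using (inj₁; inj₂; [_,_]′)
open import Data.Vec using (Vec; []; _∷_; lookup; tabulate; _++_)
open import Data.Vec.Properties using (lookup-++ˡ; lookup-++ʳ; lookup∘tabulate; tabulate-cong; tabulate∘lookup; ≡-dec)
open import Data.Empty using (⊥-elim)
open import Function using (_∘_)
open import Function.Bundles using (mk↔ₛ′; Inverse; Injection)
open import Function.Properties.Inverse using (↔-sym; ↔-trans; ↔⇒↣)
open import Relation.Nullary using (Dec; yes; no; ¬_)
open import Relation.Binary.PropositionalEquality
  using (_≢_; refl; sym; trans; cong; cong₂; subst; subst₂; module ≡-Reasoning)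
open import Algebra.Properties.Semiring.Sum +-*-semiring
  using (sum; sum-syntax; sum-cong-≗; ∑-distrib-+; ∑-comm; ∑-permute; *-distribˡ-sum; *-distribʳ-sum)

open Inverse using (to; from; strictlyInverseˡ; strictlyInverseʳ)

sum-const : ∀ k c → ∑[ i < k ] c ≡ k * c
sum-const zero    c = refl
sum-const (suc k) c = cong (c +_) (sum-const k c)

sum-split : ∀ a b (f : Fin (a + b) → ℕ) →
            sum f ≡ ∑[ i < a ] f (i ↑ˡ b) + ∑[ j < b ] f (a ↑ʳ j)
sum-split zero    b f = refl
sum-split (suc a) b f = trans (cong (f zero +_) (sum-split a b (f ∘ suc))) (sym (+-assoc (f zero) _ _))

sum-combine : ∀ a b (f : Fin (a * b) → ℕ) → sum f ≡ ∑[ i < a ] ∑[ j < b ] f (combine i j)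
sum-combine zero    b f = refl
sum-combine (suc a) b f =
  trans (sum-split b (a * b) f) (cong (∑[ j < b ] f (j ↑ˡ (a * b)) +_) (sum-combine a b (f ∘ (b ↑ʳ_))))

sumBelow : ℕ → (ℕ → ℕ) → ℕ
sumBelow k F = ∑[ i < k ] F (toℕ i)

sumBelow-cong : ∀ k {F G : ℕ → ℕ} → (∀ x → x < k → F x ≡ G x) → sumBelow k F ≡ sumBelow k G
sumBelow-cong k F≡G = sum-cong-≗ {k} (λ i → F≡G (toℕ i) (Fin.toℕ<n i))

sumBelow-zero : ∀ k {F : ℕ → ℕ} → (∀ x → x < k → F x ≡ 0) → sumBelow k F ≡ 0
sumBelow-zero k F≡0 = trans (sumBelow-cong k F≡0) (trans (sum-const k 0) (*-zeroʳ k))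

sumBelow-+ : ∀ a b (F : ℕ → ℕ) → sumBelow (a + b) F ≡ sumBelow a F + sumBelow b (λ x → F (a + x))
sumBelow-+ zero    b F = refl
sumBelow-+ (suc a) b F = trans (cong (F 0 +_) (sumBelow-+ a b (F ∘ suc))) (sym (+-assoc (F 0) _ _))

sumBelow-* : ∀ a b (F : ℕ → ℕ) → sumBelow (a * b) F ≡ sumBelow a (λ y → sumBelow b (λ x → F (y * b + x)))
sumBelow-* zero    b F = refl
sumBelow-* (suc a) b F = trans (sumBelow-+ b (a * b) F) (cong (sumBelow b F +_)
  (trans (sumBelow-* a b (λ x → F (b + x)))
         (sumBelow-cong a (λ y _ → sumBelow-cong b (λ x _ → cong F (sym (+-assoc b (y * b) x)))))))

sumBelow-periodic : ∀ c P (F : ℕ → ℕ) → (∀ y x → F (y * P + x) ≡ F x) →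
                    sumBelow (c * P) F ≡ c * sumBelow P F
sumBelow-periodic c P F periodic = trans (sumBelow-* c P F)
  (trans (sumBelow-cong c (λ y _ → sumBelow-cong P (λ x _ → periodic y x))) (sum-const c (sumBelow P F)))

sumBelow-single : ∀ P {F : ℕ → ℕ} x₀ → x₀ < P → F x₀ ≡ 1 → (∀ x → x < P → x ≢ x₀ → F x ≡ 0) →
                  sumBelow P F ≡ 1
sumBelow-single P {F} x₀ x₀<P F₁ F₀ = begin
    sumBelow P F                                        ≡⟨ cong (λ k → sumBelow k F) (sym split) ⟩
    sumBelow (x₀ + (P ∸ x₀)) F                          ≡⟨ sumBelow-+ x₀ (P ∸ x₀) F ⟩
    sumBelow x₀ F + sumBelow (P ∸ x₀) (λ x → F (x₀ + x)) ≡⟨ cong₂ _+_ below (from-x₀ (P ∸ x₀) split (m<n⇒0<n∸m x₀<P)) ⟩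
    1                                                   ∎
  where
  open ≡-Reasoning
  split : x₀ + (P ∸ x₀) ≡ P
  split = m+[n∸m]≡n (<⇒≤ x₀<P)
  below : sumBelow x₀ F ≡ 0
  below = sumBelow-zero x₀ (λ x x<x₀ → F₀ x (<-trans x<x₀ x₀<P) (<⇒≢ x<x₀))
  from-x₀ : ∀ k → x₀ + k ≡ P → 0 < k → sumBelow k (λ x → F (x₀ + x)) ≡ 1
  from-x₀ (suc k) x₀+k≡P _ = cong₂ _+_ (trans (cong F (+-identityʳ x₀)) F₁)
    (sumBelow-zero k (λ x x<k → F₀ (x₀ + suc x)
      (subst (x₀ + suc x <_) x₀+k≡P (+-monoʳ-< x₀ (s≤s x<k)))
      (λ eq → 1+n≢0 (+-cancelˡ-≡ x₀ (suc x) 0 (trans eq (sym (+-identityʳ x₀)))))))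

𝟙 : ∀ {p} {P : Set p} → Dec P → ℕ
𝟙 (yes _) = 1
𝟙 (no _)  = 0

𝟙-yes : ∀ {p} {P : Set p} (d : Dec P) → P → 𝟙 d ≡ 1
𝟙-yes (yes _) _ = refl
𝟙-yes (no ¬p) p = ⊥-elim (¬p p)

𝟙-no : ∀ {p} {P : Set p} (d : Dec P) → ¬ P → 𝟙 d ≡ 0
𝟙-no (yes p) ¬p = ⊥-elim (¬p p)
𝟙-no (no _)  _  = refl

𝟙-cong : ∀ {p q} {P : Set p} {Q : Set q} (d : Dec P) (e : Dec Q) → (P → Q) → (Q → P) → 𝟙 d ≡ 𝟙 e
𝟙-cong (yes _) (yes _) _ _ = refl
𝟙-cong (yes p) (no ¬q) f _ = ⊥-elim (¬q (f p))
𝟙-cong (no ¬p) (yes q) _ g = ⊥-elim (¬p (g q))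
𝟙-cong (no _)  (no _)  _ _ = refl

𝟙-× : ∀ {p a b} {P : Set p} {A : Set a} {B : Set b} (d : Dec P) (x : Dec A) (y : Dec B) →
      (P → A × B) → (A → B → P) → 𝟙 d ≡ 𝟙 x * 𝟙 y
𝟙-× (yes _) (yes _) (yes _) _ _ = refl
𝟙-× (yes p) (yes _) (no ¬b) f _ = ⊥-elim (¬b (proj₂ (f p)))
𝟙-× (yes p) (no ¬a) _       f _ = ⊥-elim (¬a (proj₁ (f p)))
𝟙-× (no ¬p) (yes a) (yes b) _ g = ⊥-elim (¬p (g a b))
𝟙-× (no _)  (yes _) (no _)  _ _ = refl
𝟙-× (no _)  (no _)  _       _ _ = refl

Irrelevant : ∀ {A : Set} → (A → Set) → Set
Irrelevant {A} P = ∀ (x : A) (p p′ : P x) → p ≡ p′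

Σ-≡ : ∀ {A : Set} {P : A → Set} → Irrelevant P → ∀ {a b} {p : P a} {p′ : P b} → a ≡ b → (a , p) ≡ (b , p′)
Σ-≡ irr {a} refl = cong (a ,_) (irr a _ _)

count : ∀ N {P : Fin N → Set} → (∀ i → Dec (P i)) → ℕ
count N P? = ∑[ i < N ] 𝟙 (P? i)

enumerate : ∀ N {P : Fin N → Set} (P? : ∀ i → Dec (P i)) → Irrelevant P → Fin (count N P?) ↔ Σ (Fin N) P
enumerate zero    P? irr = mk↔ₛ′ (λ ()) (λ { (() , _) }) (λ { (() , _) }) (λ ())
enumerate (suc N) {P} P? irr = extend (P? zero)
  where
  rest : Fin (count N (P? ∘ suc)) ↔ Σ (Fin N) (P ∘ suc)
  rest = enumerate N (P? ∘ suc) (irr ∘ suc)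
  shift : Σ (Fin N) (P ∘ suc) → Σ (Fin (suc N)) P
  shift (i , p) = suc i , p
  shift-from : ∀ i (p : P (suc i)) → shift (to rest (from rest (i , p))) ≡ (suc i , p)
  shift-from i p = cong shift (strictlyInverseˡ rest (i , p))
  extend : (d : Dec (P zero)) → Fin (𝟙 d + count N (P? ∘ suc)) ↔ Σ (Fin (suc N)) P
  extend (yes p₀) = mk↔ₛ′ t f t∘f f∘t
    where
    t : Fin (suc (count N (P? ∘ suc))) → Σ (Fin (suc N)) P
    t zero    = zero , p₀
    t (suc j) = shift (to rest j)
    f : Σ (Fin (suc N)) P → Fin (suc (count N (P? ∘ suc)))
    f (zero  , _) = zero
    f (suc i , p) = suc (from rest (i , p))
    t∘f : ∀ x → t (f x) ≡ x
    t∘f (zero  , p) = cong (zero ,_) (irr zero p₀ p)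
    t∘f (suc i , p) = shift-from i p
    f∘t : ∀ j → f (t j) ≡ j
    f∘t zero    = refl
    f∘t (suc j) = cong suc (strictlyInverseʳ rest j)
  extend (no ¬p₀) = mk↔ₛ′ (shift ∘ to rest) f t∘f (strictlyInverseʳ rest)
    where
    f : Σ (Fin (suc N)) P → Fin (count N (P? ∘ suc))
    f (zero  , p) = ⊥-elim (¬p₀ p)
    f (suc i , p) = from rest (i , p)
    t∘f : ∀ x → shift (to rest (f x)) ≡ x
    t∘f (zero  , p) = ⊥-elim (¬p₀ p)
    t∘f (suc i , p) = shift-from i p

-- Words of length n over Fin q are coded by Fin (q ^ n), the first letter
-- being the most significant digit.
wordCode : ∀ q n → Fin (q ^ n) ↔ Word n q
wordCode q zero    = mk↔ₛ′ (λ _ → []) (λ _ → zero) (λ { [] → refl }) (λ { zero → refl })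
wordCode q (suc n) = mk↔ₛ′ decode encode decode∘encode encode∘decode
  where
  code = wordCode q n
  decode : Fin (q * q ^ n) → Word (suc n) q
  decode i = proj₁ (remQuot {q} (q ^ n) i) ∷ to code (proj₂ (remQuot {q} (q ^ n) i))
  encode : Word (suc n) q → Fin (q * q ^ n)
  encode (c ∷ w) = combine c (from code w)
  decode∘encode : ∀ w → decode (encode w) ≡ w
  decode∘encode (c ∷ w) = trans (cong (λ x → proj₁ x ∷ to code (proj₂ x)) (Fin.remQuot-combine {q} {q ^ n} c (from code w)))
                                (cong (c ∷_) (strictlyInverseˡ code w))
  encode∘decode : ∀ i → encode (decode i) ≡ i
  encode∘decode i = trans (cong (combine (proj₁ (remQuot {q} (q ^ n) i))) (strictlyInverseʳ code _))
                          (Fin.combine-remQuot {q} (q ^ n) i)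

decode-∷ : ∀ q n (c : Fin q) (j : Fin (q ^ n)) → to (wordCode q (suc n)) (combine c j) ≡ c ∷ to (wordCode q n) j
decode-∷ q n c j = cong (λ x → proj₁ x ∷ to (wordCode q n) (proj₂ x)) (Fin.remQuot-combine {q} {q ^ n} c j)

sumWords : ∀ q n → (Word n q → ℕ) → ℕ
sumWords q zero    F = F []
sumWords q (suc n) F = ∑[ c < q ] sumWords q n (λ w → F (c ∷ w))

sumWords-cong : ∀ q n {F G : Word n q → ℕ} → (∀ w → F w ≡ G w) → sumWords q n F ≡ sumWords q n G
sumWords-cong q zero    F≡G = F≡G []
sumWords-cong q (suc n) F≡G = sum-cong-≗ {q} (λ c → sumWords-cong q n (λ w → F≡G (c ∷ w)))

sumWords-code : ∀ q n (F : Word n q → ℕ) → sumWords q n F ≡ ∑[ i < q ^ n ] F (to (wordCode q n) i)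
sumWords-code q zero    F = sym (+-identityʳ (F []))
sumWords-code q (suc n) F = begin
    ∑[ c < q ] sumWords q n (λ w → F (c ∷ w))                      ≡⟨ sum-cong-≗ {q} (λ c → sumWords-code q n (λ w → F (c ∷ w))) ⟩
    ∑[ c < q ] ∑[ j < q ^ n ] F (c ∷ to (wordCode q n) j)          ≡⟨ sum-cong-≗ {q} (λ c → sum-cong-≗ {q ^ n} (λ j →
                                                                        cong F (sym (decode-∷ q n c j)))) ⟩
    ∑[ c < q ] ∑[ j < q ^ n ] F (to (wordCode q (suc n)) (combine c j)) ≡⟨ sym (sum-combine q (q ^ n) _) ⟩
    ∑[ i < q * q ^ n ] F (to (wordCode q (suc n)) i)              ∎
  where open ≡-Reasoning

sumWords-++ : ∀ q a b (F : Word (a + b) q → ℕ) →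
              sumWords q (a + b) F ≡ sumWords q a (λ u → sumWords q b (λ v → F (u ++ v)))
sumWords-++ q zero    b F = refl
sumWords-++ q (suc a) b F = sum-cong-≗ {q} (λ c → sumWords-++ q a b (λ w → F (c ∷ w)))

sumWords-sumBelow : ∀ q n k (H : ℕ → Word n q → ℕ) →
                    sumWords q n (λ w → sumBelow k (λ u → H u w)) ≡ sumBelow k (λ u → sumWords q n (H u))
sumWords-sumBelow q zero    k H = refl
sumWords-sumBelow q (suc n) k H =
  trans (sum-cong-≗ {q} (λ c → sumWords-sumBelow q n k (λ u w → H u (c ∷ w))))
        (∑-comm {q} {k} (λ c u → sumWords q n (λ w → H (toℕ u) (c ∷ w))))

sumWords-↔ : ∀ q a b (σ : Word a q ↔ Word b q) (F : Word b q → ℕ) →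
             sumWords q b F ≡ sumWords q a (λ w → F (to σ w))
sumWords-↔ q a b σ F = begin
    sumWords q b F                                         ≡⟨ sumWords-code q b F ⟩
    ∑[ i < q ^ b ] F (to (wordCode q b) i)                 ≡⟨ ∑-permute (F ∘ to (wordCode q b)) π ⟩
    ∑[ i < q ^ a ] F (to (wordCode q b) (to π i))          ≡⟨ sum-cong-≗ {q ^ a} (λ i → cong F (strictlyInverseˡ (wordCode q b) _)) ⟩
    ∑[ i < q ^ a ] F (to σ (to (wordCode q a) i))          ≡⟨ sym (sumWords-code q a (F ∘ to σ)) ⟩
    sumWords q a (λ w → F (to σ w))                        ∎
  where
  open ≡-Reasoning
  π : Fin (q ^ a) ↔ Fin (q ^ b)
  π = ↔-trans (wordCode q a) (↔-trans σ (↔-sym (wordCode q b)))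

countWords : ∀ q n {P : Word n q → Set} → (∀ w → Dec (P w)) → ℕ
countWords q n P? = sumWords q n (λ w → 𝟙 (P? w))

enumerateWords : ∀ q n {P : Word n q → Set} (P? : ∀ w → Dec (P w)) → Irrelevant P →
                 Fin (countWords q n P?) ↔ Σ (Word n q) P
enumerateWords q n {P} P? irr =
  subst (λ k → Fin k ↔ Σ (Word n q) P) (sym (sumWords-code q n (λ w → 𝟙 (P? w))))
        (↔-trans (enumerate (q ^ n) (P? ∘ decode) (irr ∘ decode)) (mk↔ₛ′ t f t∘f f∘t))
  where
  decode = to (wordCode q n)
  t : Σ (Fin (q ^ n)) (P ∘ decode) → Σ (Word n q) P
  t (i , p) = decode i , p
  f : Σ (Word n q) P → Σ (Fin (q ^ n)) (P ∘ decode)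
  f (w , p) = from (wordCode q n) w , subst P (sym (strictlyInverseˡ (wordCode q n) w)) p
  t∘f : ∀ x → t (f x) ≡ x
  t∘f (w , p) = Σ-≡ irr (strictlyInverseˡ (wordCode q n) w)
  f∘t : ∀ x → f (t x) ≡ x
  f∘t (i , p) = Σ-≡ (irr ∘ decode) (strictlyInverseʳ (wordCode q n) i)

countWords-unique : ∀ q n {k} {P : Word n q → Set} (P? : ∀ w → Dec (P w)) → Irrelevant P →
                    Fin k ↔ Σ (Word n q) P → k ≡ countWords q n P?
countWords-unique q n P? irr r = ↔⇒≡ (↔-trans r (↔-sym (enumerateWords q n P? irr)))

open +-*-Solver using (solve; _:+_; _:*_; _:=_; con)

module _ {n : ℕ} .{{_ : NonZero n}} where

  %-congˡ-+ : ∀ b {a a′} → a % n ≡ a′ % n → (a + b) % n ≡ (a′ + b) % n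
  %-congˡ-+ b {a} {a′} eq = trans (%-distribˡ-+ a b n)
    (trans (cong (λ x → (x + b % n) % n) eq) (sym (%-distribˡ-+ a′ b n)))

  %-congʳ-+ : ∀ b {a a′} → a % n ≡ a′ % n → (b + a) % n ≡ (b + a′) % n
  %-congʳ-+ b {a} {a′} eq = trans (cong (_% n) (+-comm b a))
    (trans (%-congˡ-+ b eq) (cong (_% n) (+-comm a′ b)))

  %-congʳ-* : ∀ b {a a′} → a % n ≡ a′ % n → (b * a) % n ≡ (b * a′) % n
  %-congʳ-* b {a} {a′} eq = trans (%-distribˡ-* b a n)
    (trans (cong (λ x → ((b % n) * x) % n) eq) (sym (%-distribˡ-* b a′ n)))

  %-congˡ-* : ∀ b {a a′} → a % n ≡ a′ % n → (a * b) % n ≡ (a′ * b) % n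
  %-congˡ-* b {a} {a′} eq = trans (cong (_% n) (*-comm a b))
    (trans (%-congʳ-* b eq) (cong (_% n) (*-comm b a′)))

  %≡⇒∣∸ : ∀ {a b} → b ≤ a → a % n ≡ b % n → n ∣ a ∸ b
  %≡⇒∣∸ {a} {b} _ eq = divides (a / n ∸ b / n) (begin
      a ∸ b                                      ≡⟨ cong₂ _∸_ (m≡m%n+[m/n]*n a n) (m≡m%n+[m/n]*n b n) ⟩
      (a % n + a / n * n) ∸ (b % n + b / n * n)  ≡⟨ cong (λ x → (x + a / n * n) ∸ (b % n + b / n * n)) eq ⟩
      (b % n + a / n * n) ∸ (b % n + b / n * n)  ≡⟨ [m+n]∸[m+o]≡n∸o (b % n) (a / n * n) (b / n * n) ⟩
      a / n * n ∸ b / n * n                      ≡⟨ sym (*-distribʳ-∸ n (a / n) (b / n)) ⟩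
      (a / n ∸ b / n) * n                        ∎)
    where open ≡-Reasoning

  ∣∸⇒%≡ : ∀ {a b} → b ≤ a → n ∣ a ∸ b → a % n ≡ b % n
  ∣∸⇒%≡ {a} {b} b≤a (divides k eq) = begin
      a % n             ≡⟨ cong (_% n) (sym (m+[n∸m]≡n b≤a)) ⟩
      (b + (a ∸ b)) % n ≡⟨ cong (λ x → (b + x) % n) eq ⟩
      (b + k * n) % n   ≡⟨ [m+kn]%n≡m%n b k n ⟩
      b % n             ∎
    where open ≡-Reasoning

  coprime-cancel-∸ : ∀ {q x y} → Coprime q n → y ≤ x → (q * x) % n ≡ (q * y) % n → n ∣ x ∸ y
  coprime-cancel-∸ {q} {x} {y} q⊥n y≤x eq = coprime-divisor (Coprime.sym q⊥n)
    (subst (n ∣_) (sym (*-distribˡ-∸ q x y)) (%≡⇒∣∸ (*-monoʳ-≤ q y≤x) eq))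

  coprime-cancel : ∀ {q a b} → Coprime q n → (q * a) % n ≡ (q * b) % n → a % n ≡ b % n
  coprime-cancel {q} {a} {b} q⊥n eq with ≤-total b a
  ... | inj₁ b≤a = ∣∸⇒%≡ b≤a (coprime-cancel-∸ q⊥n b≤a eq)
  ... | inj₂ a≤b = sym (∣∸⇒%≡ a≤b (coprime-cancel-∸ q⊥n a≤b (sym eq)))

  coprime-cancel-^ : ∀ {q} j {a b} → Coprime q n → (q ^ j * a) % n ≡ (q ^ j * b) % n → a % n ≡ b % n
  coprime-cancel-^ zero {a} {b} q⊥n eq =
    trans (cong (_% n) (sym (+-identityʳ a))) (trans eq (cong (_% n) (+-identityʳ b)))
  coprime-cancel-^ {q} (suc j) {a} {b} q⊥n eq = coprime-cancel-^ j q⊥n (coprime-cancel q⊥n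
    (trans (cong (_% n) (sym (*-assoc q (q ^ j) a))) (trans eq (cong (_% n) (*-assoc q (q ^ j) b)))))

coprime-∣-^ : ∀ {n q} → Coprime q n → ∀ j x → n ∣ q ^ j * x → n ∣ x
coprime-∣-^ q⊥n zero    x n∣x = subst (_ ∣_) (+-identityʳ x) n∣x
coprime-∣-^ {n} {q} q⊥n (suc j) x n∣qqʲx =
  coprime-∣-^ q⊥n j x (coprime-divisor (Coprime.sym q⊥n) (subst (n ∣_) (*-assoc q (q ^ j) x) n∣qqʲx))

divisor-pos : ∀ {d n} → 0 < n → d ∣ n → 0 < d
divisor-pos {zero}  0<n d∣n = ⊥-elim (<⇒≢ 0<n (sym (0∣⇒≡0 d∣n)))
divisor-pos {suc _} _   _   = s≤s z≤n

∣-<⇒≡0 : ∀ {P k} → k < P → P ∣ k → k ≡ 0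
∣-<⇒≡0 {k = zero}  _   _   = refl
∣-<⇒≡0 {k = suc k} k<P P∣k = ⊥-elim (<⇒≱ k<P (∣⇒≤ P∣k))

∣-∸ : ∀ {d a b} → d ∣ a → d ∣ b → d ∣ a ∸ b
∣-∸ {d} (divides x refl) (divides y refl) = divides (x ∸ y) (sym (*-distribʳ-∸ d x y))

∣+∣⇒∣ : ∀ {d a b} → d ∣ a + b → d ∣ b → d ∣ a
∣+∣⇒∣ {d} {a} {b} d∣a+b d∣b = ∣m+n∣m⇒∣n (subst (d ∣_) (+-comm a b) d∣a+b) d∣b

∣*gcd⇒ : ∀ {n} t a b → n ∣ t * gcd a b → n ∣ t * a × n ∣ t * b
∣*gcd⇒ t a b n∣ = ∣-trans n∣ (*-monoʳ-∣ t (gcd[m,n]∣m a b)) , ∣-trans n∣ (*-monoʳ-∣ t (gcd[m,n]∣n a b))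

⇒∣*gcd : ∀ {n} t a b → n ∣ t * a → n ∣ t * b → n ∣ t * gcd a b
⇒∣*gcd t a b n∣ta n∣tb = subst (_ ∣_) (sym (c*gcd[m,n]≡gcd[cm,cn] t a b)) (gcd-greatest n∣ta n∣tb)

minus-inverse : ∀ P s → 0 < P → Coprime s P → ∃ λ u → P ∣ 1 + s * u
minus-inverse (suc p) s _ s⊥P with coprime-Bézout s⊥P
... | Bézout.-+ x y eq = x , divides y (trans (cong suc (*-comm s x)) eq)
... | Bézout.+- x y eq = p * x , divides (1 + p * y) (begin
      1 + s * (p * x)          ≡⟨ cong suc (solve 3 (λ s p x → s :* (p :* x) := p :* (x :* s)) refl s p x) ⟩
      1 + p * (x * s)          ≡⟨ cong (λ z → 1 + p * z) (sym eq) ⟩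
      1 + p * (1 + y * suc p)  ≡⟨ solve 2 (λ p y → con 1 :+ p :* (con 1 :+ y :* (con 1 :+ p))
                                                := (con 1 :+ p :* y) :* (con 1 :+ p)) refl p y ⟩
      (1 + p * y) * suc p      ∎)
  where open ≡-Reasoning

module UnitCongruence (P s r : ℕ) (0<P : 0 < P) (s⊥P : Coprime s P) where

  private instance
    P≢0 : NonZero P
    P≢0 = >-nonZero 0<P

  -- Two solutions below P coincide: their difference is a multiple of P below P.
  solution-unique-≤ : ∀ {x y} → y ≤ x → x < P → P ∣ r + s * x → P ∣ r + s * y → x ≡ y
  solution-unique-≤ {x} {y} y≤x x<P P∣x P∣y = ≤-antisym (m∸n≡0⇒m≤n x∸y≡0) y≤x
    where
    P∣s[x∸y] : P ∣ s * (x ∸ y)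
    P∣s[x∸y] = subst (P ∣_) (trans ([m+n]∸[m+o]≡n∸o r (s * x) (s * y)) (sym (*-distribˡ-∸ s x y))) (∣-∸ P∣x P∣y)
    x∸y≡0 : x ∸ y ≡ 0
    x∸y≡0 = ∣-<⇒≡0 (≤-<-trans (m∸n≤m x y) x<P) (coprime-divisor (Coprime.sym s⊥P) P∣s[x∸y])

  solution-unique : ∀ {x y} → x < P → y < P → P ∣ r + s * x → P ∣ r + s * y → x ≡ y
  solution-unique {x} {y} x<P y<P P∣x P∣y with ≤-total y x
  ... | inj₁ y≤x = solution-unique-≤ y≤x x<P P∣x P∣y
  ... | inj₂ x≤y = sym (solution-unique-≤ x≤y y<P P∣y P∣x)

  -- With s·u ≡ -1, the solution is x = r·u reduced modulo P.
  solution-exists : ∃ λ x → x < P × P ∣ r + s * x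
  solution-exists with minus-inverse P s 0<P s⊥P
  ... | u , P∣1+su = (r * u) % P , m%n<n (r * u) P , m%n≡0⇒n∣m _ P (begin
        (r + s * ((r * u) % P)) % P ≡⟨ %-congʳ-+ r (%-congʳ-* s (m%n%n≡m%n (r * u) P)) ⟩
        (r + s * (r * u)) % P       ≡⟨ n∣m⇒m%n≡0 _ P P∣r+sru ⟩
        0                           ∎)
    where
    open ≡-Reasoning
    P∣r+sru : P ∣ r + s * (r * u)
    P∣r+sru = subst (P ∣_) (solve 3 (λ r s u → r :* (con 1 :+ s :* u) := r :+ s :* (r :* u)) refl r s u)
                    (∣n⇒∣m*n r P∣1+su)

  solution-count : sumBelow P (λ x → 𝟙 (P ∣? r + s * x)) ≡ 1
  solution-count with solution-exists
  ... | x₀ , x₀<P , P∣x₀ = sumBelow-single P x₀ x₀<P (𝟙-yes (P ∣? r + s * x₀) P∣x₀)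
        (λ x x<P x≢x₀ → 𝟙-no (P ∣? r + s * x) (λ P∣x → x≢x₀ (solution-unique x<P x₀<P P∣x P∣x₀)))

  solution-count-periods : ∀ c → sumBelow (c * P) (λ x → 𝟙 (P ∣? r + s * x)) ≡ c
  solution-count-periods c = trans (sumBelow-periodic c P _ periodic) (trans (cong (c *_) solution-count) (*-identityʳ c))
    where
    shift : ∀ y x → r + s * (y * P + x) ≡ (r + s * x) + s * y * P
    shift y x = solve 5 (λ r s y p x → r :+ s :* (y :* p :+ x) := (r :+ s :* x) :+ s :* y :* p) refl r s y P x
    periodic : ∀ y x → 𝟙 (P ∣? r + s * (y * P + x)) ≡ 𝟙 (P ∣? r + s * x)
    periodic y x = 𝟙-cong (P ∣? _) (P ∣? _)
      (λ P∣ → ∣+∣⇒∣ (subst (P ∣_) (shift y x) P∣) (n∣m*n (s * y)))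
      (λ P∣ → subst (P ∣_) (sym (shift y x)) (∣m∣n⇒∣m+n P∣ (n∣m*n (s * y))))

-- Dividing
-- s, g and r by e leaves a congruence modulo P = g/e with s/e a unit.
divisible-congruence-count : ∀ g s M r → 0 < g → g ∣ s * M → gcd s g ∣ r →
  g * sumBelow M (λ X → 𝟙 (g ∣? r + s * X)) ≡ M * gcd s g
divisible-congruence-count g s M r 0<g g∣sM (divides r′ r≡r′e) = begin
    g * sumBelow M (λ X → 𝟙 (g ∣? r + s * X))   ≡⟨ cong (g *_) (sumBelow-cong M (λ X _ → reduce X)) ⟩
    g * sumBelow M F                            ≡⟨ cong (λ k → g * sumBelow k F) M≡cP ⟩
    g * sumBelow (c * P) F                      ≡⟨ cong (g *_) (UnitCongruence.solution-count-periods P s′ r′ 0<P s′⊥P c) ⟩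
    g * c                                       ≡⟨ cong (_* c) g≡Pe ⟩
    P * e * c                                   ≡⟨ solve 3 (λ p e c → p :* e :* c := c :* p :* e) refl P e c ⟩
    c * P * e                                   ≡⟨ cong (_* e) (sym M≡cP) ⟩
    M * e                                       ∎
  where
  open ≡-Reasoning
  e = gcd s g
  instance
    e≢0 : NonZero e
    e≢0 = ≢-nonZero (gcd[m,n]≢0 s g (inj₂ (λ g≡0 → <⇒≢ 0<g (sym g≡0))))
  s′ = s / e
  P = g / e
  s≡s′e : s ≡ s′ * e
  s≡s′e = sym (m/n*n≡m (gcd[m,n]∣m s g))
  g≡Pe : g ≡ P * e
  g≡Pe = sym (m/n*n≡m (gcd[m,n]∣n s g))
  s′⊥P : Coprime s′ P
  s′⊥P = coprime-/gcd s g
  0<P : 0 < P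
  0<P = divisor-pos 0<g (divides e (trans g≡Pe (*-comm P e)))
  P∣M : P ∣ M
  P∣M = coprime-divisor (Coprime.sym s′⊥P) (*-cancelʳ-∣ e (subst₂ _∣_ g≡Pe sM≡s′Me g∣sM))
    where
    sM≡s′Me : s * M ≡ s′ * M * e
    sM≡s′Me = trans (cong (_* M) s≡s′e) (solve 3 (λ a b c → a :* c :* b := a :* b :* c) refl s′ M e)
  c = quotient P∣M
  M≡cP : M ≡ c * P
  M≡cP = m∣n⇒n≡quotient*m P∣M
  F : ℕ → ℕ
  F X = 𝟙 (P ∣? r′ + s′ * X)
  scaled : ∀ X → r + s * X ≡ (r′ + s′ * X) * e
  scaled X = trans (cong₂ (λ a b → a + b * X) r≡r′e s≡s′e)
    (solve 4 (λ r s x e → r :* e :+ s :* e :* x := (r :+ s :* x) :* e) refl r′ s′ X e)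
  reduce : ∀ X → 𝟙 (g ∣? r + s * X) ≡ F X
  reduce X = 𝟙-cong (g ∣? _) (P ∣? _)
    (λ g∣ → *-cancelʳ-∣ e (subst₂ _∣_ g≡Pe (scaled X) g∣))
    (λ P∣ → subst₂ _∣_ (sym g≡Pe) (sym (scaled X)) (*-monoˡ-∣ e P∣))

linear-congruence-count : ∀ g s M r → 0 < g → g ∣ s * M →
  g * sumBelow M (λ X → 𝟙 (g ∣? r + s * X)) ≡ M * gcd s g * 𝟙 (gcd s g ∣? r)
linear-congruence-count g s M r 0<g g∣sM with gcd s g ∣? r
... | yes e∣r = trans (divisible-congruence-count g s M r 0<g g∣sM e∣r) (sym (*-identityʳ (M * gcd s g)))
... | no e∤r  = trans (cong (g *_) (sumBelow-zero M (λ X _ → 𝟙-no (g ∣? r + s * X) no-solution)))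
                      (trans (*-zeroʳ g) (sym (*-zeroʳ (M * gcd s g))))
  where
  no-solution : ∀ {X} → ¬ g ∣ r + s * X
  no-solution {X} g∣ = e∤r (∣+∣⇒∣ (∣-trans (gcd[m,n]∣n s g) g∣) (∣-trans (gcd[m,n]∣m s g) (∣m⇒∣m*n X ∣-refl)))

kernel-count : ∀ n t → 0 < n → sumBelow n (λ z → 𝟙 (n ∣? t * z)) ≡ gcd t n
kernel-count n t 0<n = *-cancelˡ-≡ _ _ n {{>-nonZero 0<n}} (begin
    n * sumBelow n (λ z → 𝟙 (n ∣? t * z))      ≡⟨ linear-congruence-count n t n 0 0<n (n∣m*n t) ⟩
    n * gcd t n * 𝟙 (gcd t n ∣? 0)             ≡⟨ cong (n * gcd t n *_) (𝟙-yes (gcd t n ∣? 0) (gcd t n ∣0)) ⟩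
    n * gcd t n * 1                            ≡⟨ *-identityʳ (n * gcd t n) ⟩
    n * gcd t n                                ∎)
  where open ≡-Reasoning

multiples-count : ∀ n g → 0 < n → g ∣ n → sumBelow n (λ t → 𝟙 (n ∣? t * g)) ≡ g
multiples-count n g 0<n g∣n = begin
    sumBelow n (λ t → 𝟙 (n ∣? t * g))   ≡⟨ sumBelow-cong n (λ t _ → cong (λ x → 𝟙 (n ∣? x)) (*-comm t g)) ⟩
    sumBelow n (λ t → 𝟙 (n ∣? g * t))   ≡⟨ kernel-count n g 0<n ⟩
    gcd g n                             ≡⟨ ∣-antisym (gcd[m,n]∣m g n) (gcd-greatest ∣-refl g∣n) ⟩
    g                                   ∎
  where open ≡-Reasoning

bezout-mod : ∀ t n .{{_ : NonZero n}} → ∃ λ a → (a * t) % n ≡ gcd t n % n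
bezout-mod t n@(suc p) with Bézout.identity (gcd-GCD t n)
... | Bézout.+- x y eq = x , trans (cong (_% n) (sym eq)) ([m+kn]%n≡m%n (gcd t n) y n)
... | Bézout.-+ x y eq = p * x , (begin
      (p * x * t) % n                  ≡⟨ sym ([m+kn]%n≡m%n (p * x * t) y n) ⟩
      (p * x * t + y * n) % n          ≡⟨ cong (λ z → (p * x * t + z) % n) (sym eq) ⟩
      (p * x * t + (d + x * t)) % n    ≡⟨ cong (_% n) (solve 4 (λ p x t d → p :* x :* t :+ (d :+ x :* t)
                                                              := d :+ x :* t :* (con 1 :+ p)) refl p x t d) ⟩
      (d + x * t * n) % n              ≡⟨ [m+kn]%n≡m%n d (x * t) n ⟩
      d % n                            ∎)
  where
  open ≡-Reasoning
  d = gcd t n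

block : ∀ m (ℓ : Fin m → ℕ) (i : Fin m) → Fin (ℓ i) → Fin (sum ℓ)
block (suc m) ℓ zero    j = j ↑ˡ sum (ℓ ∘ suc)
block (suc m) ℓ (suc i) j = ℓ zero ↑ʳ block m (ℓ ∘ suc) i j

block-surjective : ∀ m (ℓ : Fin m → ℕ) (y : Fin (sum ℓ)) → ∃₂ λ i j → y ≡ block m ℓ i j
block-surjective (suc m) ℓ y with splitAt (ℓ zero) y in split≡
... | inj₁ j = zero , j , trans (sym (Fin.join-splitAt (ℓ zero) _ y)) (cong (join (ℓ zero) _) split≡)
... | inj₂ y′ with block-surjective m (ℓ ∘ suc) y′
... | i , j , y′≡ = suc i , j , trans (sym (Fin.join-splitAt (ℓ zero) _ y))
                                  (trans (cong (join (ℓ zero) _) split≡) (cong (ℓ zero ↑ʳ_) y′≡))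

onBlocks : ∀ m (ℓ : Fin m → ℕ) → (∀ i → Fin (ℓ i) → ℕ) → Fin (sum ℓ) → ℕ
onBlocks (suc m) ℓ f y = [ f zero , onBlocks m (ℓ ∘ suc) (f ∘ suc) ]′ (splitAt (ℓ zero) y)

onBlocks-↑ˡ : ∀ m ℓ f (j : Fin (ℓ zero)) → onBlocks (suc m) ℓ f (j ↑ˡ sum (ℓ ∘ suc)) ≡ f zero j
onBlocks-↑ˡ m ℓ f j = cong [ f zero , onBlocks m (ℓ ∘ suc) (f ∘ suc) ]′ (Fin.splitAt-↑ˡ (ℓ zero) j (sum (ℓ ∘ suc)))

onBlocks-↑ʳ : ∀ m ℓ f (y : Fin (sum (ℓ ∘ suc))) → onBlocks (suc m) ℓ f (ℓ zero ↑ʳ y) ≡ onBlocks m (ℓ ∘ suc) (f ∘ suc) y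
onBlocks-↑ʳ m ℓ f y = cong [ f zero , onBlocks m (ℓ ∘ suc) (f ∘ suc) ]′ (Fin.splitAt-↑ʳ (ℓ zero) (sum (ℓ ∘ suc)) y)

onBlocks-block : ∀ m ℓ f i j → onBlocks m ℓ f (block m ℓ i j) ≡ f i j
onBlocks-block (suc m) ℓ f zero    j = onBlocks-↑ˡ m ℓ f j
onBlocks-block (suc m) ℓ f (suc i) j = trans (onBlocks-↑ʳ m ℓ f _) (onBlocks-block m (ℓ ∘ suc) (f ∘ suc) i j)

sum-blocks : ∀ m (ℓ : Fin m → ℕ) (G : Fin (sum ℓ) → ℕ) → sum G ≡ ∑[ i < m ] ∑[ j < ℓ i ] G (block m ℓ i j)
sum-blocks zero    ℓ G = refl
sum-blocks (suc m) ℓ G = trans (sum-split (ℓ zero) (sum (ℓ ∘ suc)) G)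
  (cong (∑[ j < ℓ zero ] G (j ↑ˡ _) +_) (sum-blocks m (ℓ ∘ suc) (G ∘ (ℓ zero ↑ʳ_))))

pow-split : ∀ q a b x → q ^ (a + b) * x ≡ q ^ a * (q ^ b * x)
pow-split q a b x = trans (cong (_* x) (^-distribˡ-+-* q a b)) (*-assoc (q ^ a) (q ^ b) x)

-- The cyclotomic cosets S_i = {s_i, q s_i, …, q^{ℓ_i - 1} s_i} partition ℤ_n:
-- listing them block after block gives a bijection Fin (ℓ₀ + ⋯ + ℓ_{m-1}) ↔ ℤ_n.
module CosetPartition (q n : ℕ) .{{_ : NonZero n}} (q⊥n : Coprime q n) (m : ℕ) (s : Fin m → Fin n)
                      (reps : CosetReps n q m s) (ℓ : Fin m → ℕ)
                      (len : ∀ i → IsCosetLength n q (toℕ (s i)) (ℓ i)) where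

  rep : Fin m → ℕ
  rep i = toℕ (s i)

  L : ℕ
  L = sum ℓ

  cosetElem : Fin L → ℕ
  cosetElem = onBlocks m ℓ (λ i j → q ^ toℕ j * rep i)

  φ : Fin L → Fin n
  φ y = fromℕ< (m%n<n (cosetElem y) n)

  φ-block : ∀ i j → toℕ (φ (block m ℓ i j)) ≡ (q ^ toℕ j * rep i) % n
  φ-block i j = trans (Fin.toℕ-fromℕ< _) (cong (_% n) (onBlocks-block m ℓ _ i j))

  rep-cycle : ∀ i → (q ^ ℓ i * rep i) % n ≡ rep i % n
  rep-cycle i = proj₁ (proj₂ (len i))

  orbit-periodic : ∀ i j k → (q ^ (j + k * ℓ i) * rep i) % n ≡ (q ^ j * rep i) % n
  orbit-periodic i j zero    = cong (λ e → (q ^ e * rep i) % n) (+-identityʳ j)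
  orbit-periodic i j (suc k) = begin
      (q ^ (j + (ℓ i + k * ℓ i)) * rep i) % n     ≡⟨ cong (λ e → (q ^ e * rep i) % n) exponent ⟩
      (q ^ ((j + k * ℓ i) + ℓ i) * rep i) % n     ≡⟨ cong (_% n) (pow-split q (j + k * ℓ i) (ℓ i) (rep i)) ⟩
      (q ^ (j + k * ℓ i) * (q ^ ℓ i * rep i)) % n ≡⟨ %-congʳ-* (q ^ (j + k * ℓ i)) (rep-cycle i) ⟩
      (q ^ (j + k * ℓ i) * rep i) % n             ≡⟨ orbit-periodic i j k ⟩
      (q ^ j * rep i) % n                         ∎
    where
    open ≡-Reasoning
    exponent : j + (ℓ i + k * ℓ i) ≡ (j + k * ℓ i) + ℓ i
    exponent = trans (cong (j +_) (+-comm (ℓ i) (k * ℓ i))) (sym (+-assoc j _ _))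

  -- Every z is q^J s_i for some i and J, hence q^{J mod ℓ_i} s_i.
  φ-surjective : ∀ z → ∃ λ y → φ y ≡ z
  φ-surjective z with proj₂ reps z
  ... | i , J , z≡ = block m ℓ i j , Fin.toℕ-injective (begin
        toℕ (φ (block m ℓ i j))                         ≡⟨ φ-block i j ⟩
        (q ^ toℕ j * rep i) % n                         ≡⟨ cong (λ e → (q ^ e * rep i) % n) (Fin.toℕ-fromℕ< (m%n<n J (ℓ i))) ⟩
        (q ^ (J % ℓ i) * rep i) % n                     ≡⟨ sym (orbit-periodic i (J % ℓ i) (J / ℓ i)) ⟩
        (q ^ (J % ℓ i + J / ℓ i * ℓ i) * rep i) % n     ≡⟨ cong (λ e → (q ^ e * rep i) % n) (sym (m≡m%n+[m/n]*n J (ℓ i))) ⟩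
        (q ^ J * rep i) % n                             ≡⟨ sym z≡ ⟩
        toℕ z                                           ∎)
    where
    open ≡-Reasoning
    instance
      ℓ≢0 : NonZero (ℓ i)
      ℓ≢0 = >-nonZero (proj₁ (len i))
    j : Fin (ℓ i)
    j = fromℕ< (m%n<n J (ℓ i))

  -- Within a coset, distinct exponents below ℓ_i give distinct elements
  -- (this is where minimality of ℓ_i and q ⊥ n are used).
  exponent-injective : ∀ i {j j′} → j′ < ℓ i → (q ^ j * rep i) % n ≡ (q ^ j′ * rep i) % n → j′ ≤ j
  exponent-injective i {j} {j′} j′<ℓ eq with ≤-total j j′
  ... | inj₂ j′≤j = j′≤j
  ... | inj₁ j≤j′ = m∸n≡0⇒m≤n (gap-zero (j′ ∸ j) refl)
    where
    returns : rep i % n ≡ (q ^ (j′ ∸ j) * rep i) % n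
    returns = coprime-cancel-^ j q⊥n (trans eq (cong (_% n)
      (trans (cong (λ e → q ^ e * rep i) (sym (m+[n∸m]≡n j≤j′))) (pow-split q j (j′ ∸ j) (rep i)))))
    gap-zero : ∀ d → j′ ∸ j ≡ d → d ≡ 0
    gap-zero zero    _    = refl
    gap-zero (suc d) gap≡ = ⊥-elim (<⇒≱ (≤-<-trans (m∸n≤m j′ j) j′<ℓ)
      (proj₂ (proj₂ (len i)) (j′ ∸ j) (subst (0 <_) (sym gap≡) (s≤s z≤n)) (sym returns)))

  coset-injective : ∀ i i′ j j′ → j′ < ℓ i′ → (q ^ j * rep i) % n ≡ (q ^ j′ * rep i′) % n → i ≡ i′
  coset-injective i i′ j j′ j′<ℓ eq = proj₁ reps i i′ (ℓ i′ ∸ j′ + j) (sym (begin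
      (q ^ (ℓ i′ ∸ j′ + j) * rep i) % n           ≡⟨ cong (_% n) (pow-split q (ℓ i′ ∸ j′) j (rep i)) ⟩
      (q ^ (ℓ i′ ∸ j′) * (q ^ j * rep i)) % n     ≡⟨ %-congʳ-* (q ^ (ℓ i′ ∸ j′)) eq ⟩
      (q ^ (ℓ i′ ∸ j′) * (q ^ j′ * rep i′)) % n   ≡⟨ cong (_% n) (sym (pow-split q (ℓ i′ ∸ j′) j′ (rep i′))) ⟩
      (q ^ (ℓ i′ ∸ j′ + j′) * rep i′) % n         ≡⟨ cong (λ e → (q ^ e * rep i′) % n) (m∸n+n≡m (<⇒≤ j′<ℓ)) ⟩
      (q ^ ℓ i′ * rep i′) % n                     ≡⟨ rep-cycle i′ ⟩
      rep i′ % n                                  ≡⟨ m<n⇒m%n≡m (Fin.toℕ<n (s i′)) ⟩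
      rep i′                                      ∎))
    where open ≡-Reasoning

  block-injective : ∀ i i′ (j : Fin (ℓ i)) (j′ : Fin (ℓ i′)) →
                    φ (block m ℓ i j) ≡ φ (block m ℓ i′ j′) → block m ℓ i j ≡ block m ℓ i′ j′
  block-injective i i′ j j′ eq
    with coset-injective i i′ (toℕ j) (toℕ j′) (Fin.toℕ<n j′) (trans (sym (φ-block i j)) (trans (cong toℕ eq) (φ-block i′ j′)))
  ... | refl = cong (block m ℓ i) (Fin.toℕ-injective
        (≤-antisym (exponent-injective i (Fin.toℕ<n j) (sym same)) (exponent-injective i (Fin.toℕ<n j′) same)))
    where
    same : (q ^ toℕ j * rep i) % n ≡ (q ^ toℕ j′ * rep i) % n
    same = trans (sym (φ-block i j)) (trans (cong toℕ eq) (φ-block i j′))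

  φ-injective : ∀ y y′ → φ y ≡ φ y′ → y ≡ y′
  φ-injective y y′ eq with block-surjective m ℓ y | block-surjective m ℓ y′
  ... | i , j , refl | i′ , j′ , refl = block-injective i i′ j j′ eq

  φ↔ : Fin L ↔ Fin n
  φ↔ = mk↔ₛ′ φ (λ z → proj₁ (φ-surjective z)) (λ z → proj₂ (φ-surjective z))
             (λ y → φ-injective _ y (proj₂ (φ-surjective (φ y))))

-- The base-q value Σ_j q^j u_j of a word u (first letter least significant).
value : ∀ q k → Word k q → ℕ
value q k u = ∑[ j < k ] (q ^ toℕ j * toℕ (lookup u j))

value-∷ : ∀ q k c (u : Word k q) → value q (suc k) (c ∷ u) ≡ toℕ c + q * value q k u
value-∷ q k c u = cong₂ _+_ (*-identityˡ (toℕ c))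
  (trans (sum-cong-≗ {k} (λ j → *-assoc q (q ^ toℕ j) _)) (sym (*-distribˡ-sum {k} q _)))

-- Base-q expansion: every number below q^k is the value of exactly one word.
sumWords-value : ∀ q k (G : ℕ → ℕ) → sumWords q k (λ u → G (value q k u)) ≡ sumBelow (q ^ k) G
sumWords-value q zero    G = sym (+-identityʳ (G 0))
sumWords-value q (suc k) G = begin
    ∑[ c < q ] sumWords q k (λ u → G (value q (suc k) (c ∷ u)))
      ≡⟨ sum-cong-≗ {q} (λ c → trans (sumWords-cong q k (λ u → cong G (value-∷ q k c u)))
                                     (sumWords-value q k (λ Y → G (toℕ c + q * Y)))) ⟩
    ∑[ c < q ] sumBelow (q ^ k) (λ Y → G (toℕ c + q * Y))
      ≡⟨ ∑-comm {q} {q ^ k} _ ⟩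
    sumBelow (q ^ k) (λ Y → sumBelow q (λ x → G (x + q * Y)))
      ≡⟨ sumBelow-cong (q ^ k) (λ Y _ → sumBelow-cong q (λ x _ → cong G (+-comm x (q * Y)))) ⟩
    sumBelow (q ^ k) (λ Y → sumBelow q (λ x → G (q * Y + x)))
      ≡⟨ sumBelow-cong (q ^ k) (λ Y _ → sumBelow-cong q (λ x _ → cong (λ z → G (z + x)) (*-comm q Y))) ⟩
    sumBelow (q ^ k) (λ Y → sumBelow q (λ x → G (Y * q + x)))
      ≡⟨ sym (sumBelow-* (q ^ k) q G) ⟩
    sumBelow (q ^ k * q) G
      ≡⟨ cong (λ k → sumBelow k G) (*-comm (q ^ k) q) ⟩
    sumBelow (q * q ^ k) G ∎
  where open ≡-Reasoning

blockWeight : ∀ q m (s ℓ : Fin m → ℕ) → Word (sum ℓ) q → ℕ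
blockWeight q m s ℓ V = ∑[ y < sum ℓ ] (onBlocks m ℓ (λ i j → q ^ toℕ j * s i) y * toℕ (lookup V y))

blockWeight-++ : ∀ q m s ℓ (u : Word (ℓ zero) q) (v : Word (sum (ℓ ∘ suc)) q) →
  blockWeight q (suc m) s ℓ (u ++ v) ≡ s zero * value q (ℓ zero) u + blockWeight q m (s ∘ suc) (ℓ ∘ suc) v
blockWeight-++ q m s ℓ u v = trans (sum-split (ℓ zero) (sum (ℓ ∘ suc)) _) (cong₂ _+_ first rest)
  where
  coef = λ i j → q ^ toℕ j * s i
  first : ∑[ j < ℓ zero ] (onBlocks (suc m) ℓ coef (j ↑ˡ _) * toℕ (lookup (u ++ v) (j ↑ˡ _)))
        ≡ s zero * value q (ℓ zero) u
  first = trans (sum-cong-≗ {ℓ zero} (λ j →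
      trans (cong₂ (λ a b → a * toℕ b) (onBlocks-↑ˡ m ℓ coef j) (lookup-++ˡ u v j))
            (solve 3 (λ a b c → a :* b :* c := b :* (a :* c)) refl (q ^ toℕ j) (s zero) (toℕ (lookup u j)))))
    (sym (*-distribˡ-sum {ℓ zero} (s zero) _))
  rest : ∑[ y < sum (ℓ ∘ suc) ] (onBlocks (suc m) ℓ coef (ℓ zero ↑ʳ y) * toℕ (lookup (u ++ v) (ℓ zero ↑ʳ y)))
       ≡ blockWeight q m (s ∘ suc) (ℓ ∘ suc) v
  rest = sum-cong-≗ {sum (ℓ ∘ suc)} (λ y →
    cong₂ (λ a b → a * toℕ b) (onBlocks-↑ʳ m ℓ coef y) (lookup-++ʳ u v y))

solutions : ∀ q n m (s ℓ : Fin m → ℕ) → ℕ → ℕ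
solutions q n m s ℓ r = sumWords q (sum ℓ) (λ V → 𝟙 (n ∣? r + blockWeight q m s ℓ V))

-- Removing the first block: its value X ranges over all numbers below q^ℓ₀.
solutions-suc : ∀ q n m s ℓ r →
  solutions q n (suc m) s ℓ r ≡ sumBelow (q ^ ℓ zero) (λ X → solutions q n m (s ∘ suc) (ℓ ∘ suc) (r + s zero * X))
solutions-suc q n m s ℓ r = begin
    solutions q n (suc m) s ℓ r
      ≡⟨ sumWords-++ q (ℓ zero) (sum (ℓ ∘ suc)) _ ⟩
    sumWords q (ℓ zero) (λ u → sumWords q (sum (ℓ ∘ suc)) (λ v → 𝟙 (n ∣? r + blockWeight q (suc m) s ℓ (u ++ v))))
      ≡⟨ sumWords-cong q (ℓ zero) (λ u → sumWords-cong q (sum (ℓ ∘ suc)) (λ v → cong (λ z → 𝟙 (n ∣? z))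
           (trans (cong (r +_) (blockWeight-++ q m s ℓ u v)) (sym (+-assoc r _ _))))) ⟩
    sumWords q (ℓ zero) (λ u → G (value q (ℓ zero) u))
      ≡⟨ sumWords-value q (ℓ zero) G ⟩
    sumBelow (q ^ ℓ zero) G ∎
  where
  open ≡-Reasoning
  G : ℕ → ℕ
  G X = solutions q n m (s ∘ suc) (ℓ ∘ suc) (r + s zero * X)

sumSubsets-cong : ∀ m {f g : Subset m → ℕ} → (∀ I → f I ≡ g I) → sumSubsets m f ≡ sumSubsets m g
sumSubsets-cong zero    f≡g = f≡g []
sumSubsets-cong (suc m) f≡g = cong₂ _+_ (sumSubsets-cong m (f≡g ∘ (outside ∷_))) (sumSubsets-cong m (f≡g ∘ (inside ∷_)))

sumSubsets-sumBelow : ∀ m k (H : ℕ → Subset m → ℕ) →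
  sumSubsets m (λ I → sumBelow k (λ X → H X I)) ≡ sumBelow k (λ X → sumSubsets m (H X))
sumSubsets-sumBelow zero    k H = refl
sumSubsets-sumBelow (suc m) k H = trans
  (cong₂ _+_ (sumSubsets-sumBelow m k (λ X → H X ∘ (outside ∷_))) (sumSubsets-sumBelow m k (λ X → H X ∘ (inside ∷_))))
  (sym (∑-distrib-+ {k} (λ i → sumSubsets m (H (toℕ i) ∘ (outside ∷_))) (λ i → sumSubsets m (H (toℕ i) ∘ (inside ∷_)))))

gcdSub-∣ : ∀ n m (s : Fin m → ℕ) I → gcdSub n m s I ∣ n
gcdSub-∣ n zero    s []          = ∣-refl
gcdSub-∣ n (suc m) s (false ∷ I) = gcdSub-∣ n m (s ∘ suc) I
gcdSub-∣ n (suc m) s (true ∷ I)  = ∣-trans (gcd[m,n]∣n (s zero) _) (gcdSub-∣ n m (s ∘ suc) I)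

-- The first block either has value 0 or value 1 + X with X < q^{ℓ₀} - 1.
solutions-split : ∀ q n m (s ℓ : Fin (suc m) → ℕ) → 0 < q → ∀ r →
  n * solutions q n (suc m) s ℓ r ≡
  n * solutions q n m (s ∘ suc) (ℓ ∘ suc) r
    + sumBelow (q ^ ℓ zero ∸ 1) (λ X → n * solutions q n m (s ∘ suc) (ℓ ∘ suc) (r + s zero * suc X))
solutions-split q n m s ℓ 0<q r = begin
    n * solutions q n (suc m) s ℓ r         ≡⟨ cong (n *_) (solutions-suc q n m s ℓ r) ⟩
    n * sumBelow (q ^ ℓ zero) F             ≡⟨ cong (λ k → n * sumBelow k F) (sym 1+M≡q^ℓ) ⟩
    n * (F 0 + sumBelow M (F ∘ suc))        ≡⟨ *-distribˡ-+ n (F 0) _ ⟩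
    n * F 0 + n * sumBelow M (F ∘ suc)      ≡⟨ cong₂ _+_ (cong (λ z → n * F′ z) r+s₀0≡r) (*-distribˡ-sum {M} n _) ⟩
    n * F′ r + sumBelow M (λ X → n * F (suc X)) ∎
  where
  open ≡-Reasoning
  M = q ^ ℓ zero ∸ 1
  1+M≡q^ℓ : suc M ≡ q ^ ℓ zero
  1+M≡q^ℓ = m+[n∸m]≡n {1} (m^n>0 q {{>-nonZero 0<q}} (ℓ zero))
  F′ : ℕ → ℕ
  F′ = solutions q n m (s ∘ suc) (ℓ ∘ suc)
  F : ℕ → ℕ
  F X = F′ (r + s zero * X)
  r+s₀0≡r : r + s zero * 0 ≡ r
  r+s₀0≡r = trans (cong (r +_) (*-zeroʳ (s zero))) (+-identityʳ r)

-- The terms contributed by adjoining a new block with nonzero value X + 1: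
-- a linear congruence in X modulo g, counted by linear-congruence-count.
shifted-term-sum : ∀ g p s M r → 0 < g → g ∣ s * M →
  sumBelow M (λ X → g * p * 𝟙 (g ∣? r + s * suc X)) ≡ gcd s g * (M * p) * 𝟙 (gcd s g ∣? r)
shifted-term-sum g p s M r 0<g g∣sM = begin
    sumBelow M (λ X → g * p * 𝟙 (g ∣? r + s * suc X))
      ≡⟨ sumBelow-cong M (λ X _ → cong (λ z → g * p * 𝟙 (g ∣? z))
           (solve 3 (λ r s x → r :+ s :* (con 1 :+ x) := (r :+ s) :+ s :* x) refl r s X)) ⟩
    sumBelow M (λ X → g * p * 𝟙 (g ∣? (r + s) + s * X))
      ≡⟨ sym (*-distribˡ-sum {M} (g * p) _) ⟩
    g * p * sumBelow M (λ X → 𝟙 (g ∣? (r + s) + s * X))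
      ≡⟨ solve 3 (λ a b c → a :* b :* c := b :* (a :* c)) refl g p _ ⟩
    p * (g * sumBelow M (λ X → 𝟙 (g ∣? (r + s) + s * X)))
      ≡⟨ cong (p *_) (linear-congruence-count g s M (r + s) 0<g g∣sM) ⟩
    p * (M * e * 𝟙 (e ∣? r + s))
      ≡⟨ cong (λ z → p * (M * e * z)) (𝟙-cong (e ∣? r + s) (e ∣? r)
           (λ e∣ → ∣+∣⇒∣ e∣ (gcd[m,n]∣m s g)) (λ e∣ → ∣m∣n⇒∣m+n e∣ (gcd[m,n]∣m s g))) ⟩
    p * (M * e * 𝟙 (e ∣? r))
      ≡⟨ solve 4 (λ p m e i → p :* (m :* e :* i) := e :* (m :* p) :* i) refl p M e (𝟙 (e ∣? r)) ⟩
    e * (M * p) * 𝟙 (e ∣? r) ∎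
  where
  open ≡-Reasoning
  e = gcd s g

-- Counting block words by weight: if n ∣ s_i (q^{ℓ_i} - 1) for every block, then
--   n · #{V : r + weight(V) ≡ 0 (mod n)} = Σ_I g_I · ∏_{i∈I} (q^{ℓ_i} - 1) · [g_I ∣ r],
-- with g_I = gcd(n, gcd(s_i)_{i∈I}); by induction on the number of blocks,
-- separating the value X = 0 of the first block (i ∉ I) from X > 0 (i ∈ I).
solutions-formula : ∀ q n m (s ℓ : Fin m → ℕ) → 0 < n → 0 < q → (∀ i → n ∣ s i * (q ^ ℓ i ∸ 1)) → ∀ r →
  n * solutions q n m s ℓ r ≡
  sumSubsets m (λ I → gcdSub n m s I * prodSub m (λ i → q ^ ℓ i ∸ 1) I * 𝟙 (gcdSub n m s I ∣? r))
solutions-formula q n zero s ℓ 0<n 0<q n∣ r =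
  trans (cong (λ z → n * 𝟙 (n ∣? z)) (+-identityʳ r)) (cong (_* 𝟙 (n ∣? r)) (sym (*-identityʳ n)))
solutions-formula q n (suc m) s ℓ 0<n 0<q n∣ r = begin
    n * solutions q n (suc m) s ℓ r
      ≡⟨ solutions-split q n m s ℓ 0<q r ⟩
    n * solutions q n m s′ ℓ′ r + sumBelow M (λ X → n * solutions q n m s′ ℓ′ (r + s zero * suc X))
      ≡⟨ cong₂ _+_ (IH r) (sumBelow-cong M (λ X _ → IH (r + s zero * suc X))) ⟩
    sumSubsets m (λ I → T I r) + sumBelow M (λ X → sumSubsets m (λ I → T I (r + s zero * suc X)))
      ≡⟨ cong (sumSubsets m (λ I → T I r) +_) (sym (sumSubsets-sumBelow m M (λ X I → T I (r + s zero * suc X)))) ⟩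
    sumSubsets m (λ I → T I r) + sumSubsets m (λ I → sumBelow M (λ X → T I (r + s zero * suc X)))
      ≡⟨ cong (sumSubsets m (λ I → T I r) +_) (sumSubsets-cong m (λ I →
           shifted-term-sum (g I) (p I) (s zero) M r (divisor-pos 0<n (gcdSub-∣ n m s′ I))
                            (∣-trans (gcdSub-∣ n m s′ I) (n∣ zero)))) ⟩
    sumSubsets m (λ I → T I r) + sumSubsets m (λ I → gcd (s zero) (g I) * (M * p I) * 𝟙 (gcd (s zero) (g I) ∣? r)) ∎
  where
  open ≡-Reasoning
  s′ = s ∘ suc
  ℓ′ = ℓ ∘ suc
  M = q ^ ℓ zero ∸ 1
  g : Subset m → ℕ
  g = gcdSub n m s′
  p : Subset m → ℕ
  p = prodSub m (λ i → q ^ ℓ′ i ∸ 1)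
  T : Subset m → ℕ → ℕ
  T I x = g I * p I * 𝟙 (g I ∣? x)
  IH : ∀ x → n * solutions q n m s′ ℓ′ x ≡ sumSubsets m (λ I → T I x)
  IH = solutions-formula q n m s′ ℓ′ 0<n 0<q (n∣ ∘ suc)

vecSum-tabulate : ∀ k (f : Fin k → ℕ) → Data.Vec.sum (tabulate f) ≡ sum f
vecSum-tabulate zero    f = refl
vecSum-tabulate (suc k) f = cong (f zero +_) (vecSum-tabulate k (f ∘ suc))

sum-%-cong : ∀ {n} .{{_ : NonZero n}} k {f g : Fin k → ℕ} → (∀ y → f y % n ≡ g y % n) → sum f % n ≡ sum g % n
sum-%-cong zero    f≡g = refl
sum-%-cong {n} (suc k) {f} {g} f≡g =
  trans (%-congˡ-+ (sum (f ∘ suc)) (f≡g zero)) (%-congʳ-+ (g zero) (sum-%-cong k (f≡g ∘ suc)))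

vec-ext : ∀ {A : Set} {k} {v w : Vec A k} → (∀ i → lookup v i ≡ lookup w i) → v ≡ w
vec-ext {v = v} {w} v≗w = trans (sym (tabulate∘lookup v)) (trans (tabulate-cong v≗w) (tabulate∘lookup w))

relabel : ∀ {a b q} → Fin a ↔ Fin b → Word a q ↔ Word b q
relabel π = mk↔ₛ′ (λ v → tabulate (lookup v ∘ from π)) (λ w → tabulate (lookup w ∘ to π))
  (λ w → vec-ext (λ z → trans (lookup∘tabulate _ z)
                          (trans (lookup∘tabulate _ (from π z)) (cong (lookup w) (strictlyInverseˡ π z)))))
  (λ v → vec-ext (λ y → trans (lookup∘tabulate _ y)
                          (trans (lookup∘tabulate _ (to π y)) (cong (lookup v) (strictlyInverseʳ π y)))))

product : (m : ℕ) → (Fin m → ℕ) → ℕ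
product zero    f = 1
product (suc m) f = f zero * product m (f ∘ suc)

product-cong : ∀ m {f g : Fin m → ℕ} → (∀ i → f i ≡ g i) → product m f ≡ product m g
product-cong zero    f≡g = refl
product-cong (suc m) f≡g = cong₂ _*_ (f≡g zero) (product-cong m (f≡g ∘ suc))

product-^ : ∀ q m (c : Fin m → ℕ) → product m (λ i → q ^ c i) ≡ q ^ sum c
product-^ q zero    c = refl
product-^ q (suc m) c = trans (cong (q ^ c zero *_) (product-^ q m (c ∘ suc))) (sym (^-distribˡ-+-* q (c zero) _))

sumSubsets-*ˡ : ∀ m c (H : Subset m → ℕ) → c * sumSubsets m H ≡ sumSubsets m (λ I → c * H I)
sumSubsets-*ˡ zero    c H = refl
sumSubsets-*ˡ (suc m) c H = trans (*-distribˡ-+ c _ _) (cong₂ _+_ (sumSubsets-*ˡ m c _) (sumSubsets-*ˡ m c _))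

prodSub-* : ∀ m (f g : Fin m → ℕ) I → prodSub m f I * prodSub m g I ≡ prodSub m (λ i → f i * g i) I
prodSub-* zero    f g []          = refl
prodSub-* (suc m) f g (false ∷ I) = prodSub-* m (f ∘ suc) (g ∘ suc) I
prodSub-* (suc m) f g (true ∷ I)  =
  trans (solve 4 (λ a b c d → a :* b :* (c :* d) := a :* c :* (b :* d)) refl (f zero) _ (g zero) _)
        (cong (f zero * g zero *_) (prodSub-* m (f ∘ suc) (g ∘ suc) I))

sumSubsets-prodSub : ∀ m (h : Fin m → ℕ) → sumSubsets m (prodSub m h) ≡ product m (λ i → 1 + h i)
sumSubsets-prodSub zero    h = refl
sumSubsets-prodSub (suc m) h = begin
    sumSubsets m (prodSub m (h ∘ suc)) + sumSubsets m (λ I → h zero * prodSub m (h ∘ suc) I)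
      ≡⟨ cong (sumSubsets m (prodSub m (h ∘ suc)) +_) (sym (sumSubsets-*ˡ m (h zero) _)) ⟩
    sumSubsets m (prodSub m (h ∘ suc)) + h zero * sumSubsets m (prodSub m (h ∘ suc))
      ≡⟨ cong (λ z → z + h zero * z) (sumSubsets-prodSub m (h ∘ suc)) ⟩
    P + h zero * P
      ≡⟨ solve 2 (λ a b → b :+ a :* b := (con 1 :+ a) :* b) refl (h zero) P ⟩
    (1 + h zero) * P ∎
  where
  open ≡-Reasoning
  P = product m (λ i → 1 + h (suc i))

𝟙-∣-gcdSub : ∀ n t m (s : Fin m → ℕ) I → 𝟙 (n ∣? t * gcdSub n m s I) ≡ prodSub m (λ i → 𝟙 (n ∣? t * s i)) I
𝟙-∣-gcdSub n t zero    s []          = 𝟙-yes (n ∣? t * n) (n∣m*n t)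
𝟙-∣-gcdSub n t (suc m) s (false ∷ I) = 𝟙-∣-gcdSub n t m (s ∘ suc) I
𝟙-∣-gcdSub n t (suc m) s (true ∷ I)  =
  trans (𝟙-× (n ∣? t * gcd (s zero) g) (n ∣? t * s zero) (n ∣? t * g) (∣*gcd⇒ t (s zero) g) (⇒∣*gcd t (s zero) g))
        (cong (𝟙 (n ∣? t * s zero) *_) (𝟙-∣-gcdSub n t m (s ∘ suc) I))
  where g = gcdSub n m (s ∘ suc) I

1+𝟙*[q^ℓ∸1] : ∀ q ℓ {P : Set} (d : Dec P) → 0 < q → 1 + 𝟙 d * (q ^ ℓ ∸ 1) ≡ q ^ (𝟙 d * ℓ)
1+𝟙*[q^ℓ∸1] q ℓ (yes _) 0<q = trans (cong suc (+-identityʳ _))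
  (trans (m+[n∸m]≡n {1} (m^n>0 q {{>-nonZero 0<q}} ℓ)) (cong (q ^_) (sym (+-identityʳ ℓ))))
1+𝟙*[q^ℓ∸1] q ℓ (no _)  0<q = refl

module Cosets (q n : ℕ) (0<q : 0 < q) .{{_ : NonZero n}} (q⊥n : Coprime q n) (m : ℕ) (s : Fin m → Fin n)
              (reps : CosetReps n q m s) (ℓ : Fin m → ℕ)
              (len : ∀ i → IsCosetLength n q (toℕ (s i)) (ℓ i)) where

  open CosetPartition q n q⊥n m s reps ℓ len

  0<n : 0 < n
  0<n = >-nonZero⁻¹ n

  n∣rep*[q^ℓ∸1] : ∀ i → n ∣ rep i * (q ^ ℓ i ∸ 1)
  n∣rep*[q^ℓ∸1] i = subst (n ∣_) eq (%≡⇒∣∸ rep≤ (rep-cycle i))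
    where
    rep≤ : rep i ≤ q ^ ℓ i * rep i
    rep≤ = m≤n*m (rep i) (q ^ ℓ i) {{m^n≢0 q (ℓ i) {{>-nonZero 0<q}}}}
    eq : q ^ ℓ i * rep i ∸ rep i ≡ rep i * (q ^ ℓ i ∸ 1)
    eq = trans (cong (q ^ ℓ i * rep i ∸_) (sym (*-identityˡ (rep i))))
               (trans (sym (*-distribʳ-∸ (rep i) (q ^ ℓ i) 1)) (*-comm _ (rep i)))

  -- Reading a word on ℤ_n coset by coset; the weight Σ z f(z) becomes the block weight.
  byCosets : Word L q ↔ Word n q
  byCosets = relabel φ↔

  weight-byCosets : ∀ V → weight n q (to byCosets V) % n ≡ blockWeight q m rep ℓ V % n
  weight-byCosets V = begin
      weight n q (to byCosets V) % n
        ≡⟨ cong (_% n) (trans (vecSum-tabulate n _) (sum-cong-≗ {n} (λ z → cong (λ x → toℕ z * toℕ x) (lookup∘tabulate _ z)))) ⟩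
      ∑[ z < n ] (toℕ z * toℕ (lookup V (from φ↔ z))) % n
        ≡⟨ cong (_% n) (∑-permute (λ z → toℕ z * toℕ (lookup V (from φ↔ z))) φ↔) ⟩
      ∑[ y < L ] (toℕ (φ y) * toℕ (lookup V (from φ↔ (φ y)))) % n
        ≡⟨ sum-%-cong L (λ y → trans (cong (λ w → (toℕ (φ y) * toℕ (lookup V w)) % n) (strictlyInverseʳ φ↔ y))
                                     (%-congˡ-* (toℕ (lookup V y)) (trans (cong (_% n) (Fin.toℕ-fromℕ< _)) (m%n%n≡m%n _ n)))) ⟩
      blockWeight q m rep ℓ V % n ∎
    where open ≡-Reasoning

  isF? : ∀ f → Dec (weight n q f % n ≡ 0)
  isF? f = weight n q f % n ≟ 0

  F-count : n * countWords q n isF? ≡ nTimesRHS n q m s ℓ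
  F-count = begin
      n * sumWords q n (λ f → 𝟙 (isF? f))
        ≡⟨ cong (n *_) (sumWords-↔ q L n byCosets _) ⟩
      n * sumWords q L (λ V → 𝟙 (isF? (to byCosets V)))
        ≡⟨ cong (n *_) (sumWords-cong q L (λ V → 𝟙-cong (isF? (to byCosets V)) (n ∣? 0 + blockWeight q m rep ℓ V)
             (λ w≡0 → m%n≡0⇒n∣m _ n (trans (sym (weight-byCosets V)) w≡0))
             (λ n∣ → trans (weight-byCosets V) (n∣m⇒m%n≡0 _ n n∣)))) ⟩
      n * solutions q n m rep ℓ 0
        ≡⟨ solutions-formula q n m rep ℓ 0<n 0<q n∣rep*[q^ℓ∸1] 0 ⟩
      sumSubsets m (λ I → gcdSub n m rep I * prodSub m (λ i → q ^ ℓ i ∸ 1) I * 𝟙 (gcdSub n m rep I ∣? 0))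
        ≡⟨ sumSubsets-cong m (λ I → trans (cong (gcdSub n m rep I * prodSub m (λ i → q ^ ℓ i ∸ 1) I *_)
             (𝟙-yes (gcdSub n m rep I ∣? 0) (_ ∣0))) (*-identityʳ _)) ⟩
      nTimesRHS n q m s ℓ ∎
    where open ≡-Reasoning

  -- Σ_i [n ∣ t s_i] ℓ_i counts the z ∈ ℤ_n with n ∣ t z: each coset S_i
  -- contributes all or none of its ℓ_i elements, since q is a unit.
  coset-kernel-count : ∀ t → ∑[ i < m ] (𝟙 (n ∣? t * rep i) * ℓ i) ≡ sumBelow n (λ z → 𝟙 (n ∣? t * z))
  coset-kernel-count t = sym (begin
      ∑[ z < n ] G (toℕ z)                                   ≡⟨ ∑-permute (G ∘ toℕ) φ↔ ⟩
      ∑[ y < L ] G (toℕ (φ y))                               ≡⟨ sum-blocks m ℓ (G ∘ toℕ ∘ φ) ⟩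
      ∑[ i < m ] ∑[ j < ℓ i ] G (toℕ (φ (block m ℓ i j)))    ≡⟨ sum-cong-≗ {m} (λ i → trans (sum-cong-≗ {ℓ i} (G-block i))
                                                                                          (sum-const (ℓ i) _)) ⟩
      ∑[ i < m ] (ℓ i * 𝟙 (n ∣? t * rep i))                  ≡⟨ sum-cong-≗ {m} (λ i → *-comm (ℓ i) _) ⟩
      ∑[ i < m ] (𝟙 (n ∣? t * rep i) * ℓ i)                  ∎)
    where
    open ≡-Reasoning
    G : ℕ → ℕ
    G z = 𝟙 (n ∣? t * z)
    reorder : ∀ i (j : Fin (ℓ i)) → t * (q ^ toℕ j * rep i) ≡ q ^ toℕ j * (t * rep i)
    reorder i j = solve 3 (λ t a b → t :* (a :* b) := a :* (t :* b)) refl t (q ^ toℕ j) (rep i)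
    reduce : ∀ i (j : Fin (ℓ i)) → (t * toℕ (φ (block m ℓ i j))) % n ≡ (t * (q ^ toℕ j * rep i)) % n
    reduce i j = trans (cong (λ z → (t * z) % n) (φ-block i j)) (%-congʳ-* t (m%n%n≡m%n _ n))
    G-block : ∀ i (j : Fin (ℓ i)) → G (toℕ (φ (block m ℓ i j))) ≡ 𝟙 (n ∣? t * rep i)
    G-block i j = 𝟙-cong (n ∣? _) (n ∣? _)
      (λ n∣ → coprime-∣-^ q⊥n (toℕ j) (t * rep i)
                (subst (n ∣_) (reorder i j) (m%n≡0⇒n∣m _ n (trans (sym (reduce i j)) (n∣m⇒m%n≡0 _ n n∣)))))
      (λ n∣ → m%n≡0⇒n∣m _ n (trans (reduce i j) (n∣m⇒m%n≡0 _ n (subst (n ∣_) (sym (reorder i j)) (∣n⇒∣m*n (q ^ toℕ j) n∣)))))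

  RHS-gcd-sum : nTimesRHS n q m s ℓ ≡ sumBelow n (λ t → q ^ gcd t n)
  RHS-gcd-sum = begin
      sumSubsets m (λ I → g I * a I)
        ≡⟨ sumSubsets-cong m (λ I → cong (_* a I) (sym (multiples-count n (g I) 0<n (gcdSub-∣ n m rep I)))) ⟩
      sumSubsets m (λ I → sumBelow n (λ t → 𝟙 (n ∣? t * g I)) * a I)
        ≡⟨ sumSubsets-cong m (λ I → *-distribʳ-sum {n} (a I) _) ⟩
      sumSubsets m (λ I → sumBelow n (λ t → 𝟙 (n ∣? t * g I) * a I))
        ≡⟨ sumSubsets-sumBelow m n (λ t I → 𝟙 (n ∣? t * g I) * a I) ⟩
      sumBelow n (λ t → sumSubsets m (λ I → 𝟙 (n ∣? t * g I) * a I))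
        ≡⟨ sumBelow-cong n (λ t _ → sumSubsets-cong m (λ I →
             trans (cong (_* a I) (𝟙-∣-gcdSub n t m rep I)) (prodSub-* m (b t) (λ i → q ^ ℓ i ∸ 1) I))) ⟩
      sumBelow n (λ t → sumSubsets m (prodSub m (λ i → b t i * (q ^ ℓ i ∸ 1))))
        ≡⟨ sumBelow-cong n (λ t _ → sumSubsets-prodSub m (λ i → b t i * (q ^ ℓ i ∸ 1))) ⟩
      sumBelow n (λ t → product m (λ i → 1 + b t i * (q ^ ℓ i ∸ 1)))
        ≡⟨ sumBelow-cong n (λ t _ → product-cong m (λ i → 1+𝟙*[q^ℓ∸1] q (ℓ i) (n ∣? t * rep i) 0<q)) ⟩
      sumBelow n (λ t → product m (λ i → q ^ (b t i * ℓ i)))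
        ≡⟨ sumBelow-cong n (λ t _ → product-^ q m (λ i → b t i * ℓ i)) ⟩
      sumBelow n (λ t → q ^ ∑[ i < m ] (b t i * ℓ i))
        ≡⟨ sumBelow-cong n (λ t _ → cong (q ^_) (trans (coset-kernel-count t) (kernel-count n t 0<n))) ⟩
      sumBelow n (λ t → q ^ gcd t n) ∎
    where
    open ≡-Reasoning
    g : Subset m → ℕ
    g = gcdSub n m rep
    a : Subset m → ℕ
    a = prodSub m (λ i → q ^ ℓ i ∸ 1)
    b : ℕ → Fin m → ℕ
    b t i = 𝟙 (n ∣? t * rep i)

minUpTo : ℕ → (ℕ → ℕ) → ℕ
minUpTo zero    f = f 0
minUpTo (suc k) f = f (suc k) ⊓ minUpTo k f

minUpTo-≤ : ∀ k f {x} → x ≤ k → minUpTo k f ≤ f x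
minUpTo-≤ zero    f z≤n = ≤-refl
minUpTo-≤ (suc k) f x≤ with m≤n⇒m<n∨m≡n x≤
... | inj₁ x<1+k = ≤-trans (m⊓n≤n _ _) (minUpTo-≤ k f (s≤s⁻¹ x<1+k))
... | inj₂ refl  = m⊓n≤m _ _

minUpTo-attained : ∀ k f → ∃ λ x → x ≤ k × minUpTo k f ≡ f x
minUpTo-attained zero    f = 0 , z≤n , refl
minUpTo-attained (suc k) f with ≤-total (f (suc k)) (minUpTo k f)
... | inj₁ new≤ = suc k , ≤-refl , m≤n⇒m⊓n≡m new≤
... | inj₂ old≤ with minUpTo-attained k f
...   | x , x≤k , eq = x , m≤n⇒m≤1+n x≤k , trans (m≥n⇒m⊓n≡n old≤) eq

module Rotation (n q : ℕ) .{{_ : NonZero n}} where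

  W : Set
  W = Word n q

  _≟W_ : (v w : W) → Dec (v ≡ w)
  _≟W_ = ≡-dec Fin._≟_

  idx : ℕ → Fin n
  idx x = fromℕ< (m%n<n x n)

  toℕ-idx : ∀ x → toℕ (idx x) ≡ x % n
  toℕ-idx x = Fin.toℕ-fromℕ< (m%n<n x n)

  idx-cong : ∀ {x y} → x % n ≡ y % n → idx x ≡ idx y
  idx-cong eq = Fin.toℕ-injective (trans (toℕ-idx _) (trans eq (sym (toℕ-idx _))))

  idx-toℕ : ∀ (i : Fin n) → idx (toℕ i) ≡ i
  idx-toℕ i = Fin.toℕ-injective (trans (toℕ-idx _) (m<n⇒m%n≡m (Fin.toℕ<n i)))

  idx-+ : ∀ x y → idx (toℕ (idx x) + y) ≡ idx (x + y)
  idx-+ x y = idx-cong (%-congˡ-+ y (trans (cong (_% n) (toℕ-idx x)) (m%n%n≡m%n x n)))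

  rotate : ℕ → W → W
  rotate k v = tabulate (λ i → lookup v (rotIdx n k i))

  lookup-rotate : ∀ k v i → lookup (rotate k v) i ≡ lookup v (idx (toℕ i + k))
  lookup-rotate k v i = lookup∘tabulate _ i

  RotEquiv⇒ : ∀ v w → RotEquiv n q v w → ∃ λ k → w ≡ rotate k v
  RotEquiv⇒ v w (k , w≗) = k , vec-ext (λ i → trans (w≗ i) (sym (lookup-rotate k v i)))

  ⇒RotEquiv : ∀ v w k → w ≡ rotate k v → RotEquiv n q v w
  ⇒RotEquiv v .(rotate k v) k refl = k , lookup-rotate k v

  rotate-cong : ∀ {j k} v → j % n ≡ k % n → rotate j v ≡ rotate k v
  rotate-cong {j} {k} v eq = vec-ext (λ i → trans (lookup-rotate j v i)
    (trans (cong (lookup v) (idx-cong (%-congʳ-+ (toℕ i) eq))) (sym (lookup-rotate k v i))))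

  rotate-rotate : ∀ j k v → rotate k (rotate j v) ≡ rotate (k + j) v
  rotate-rotate j k v = vec-ext (λ i → begin
      lookup (rotate k (rotate j v)) i           ≡⟨ lookup-rotate k (rotate j v) i ⟩
      lookup (rotate j v) (idx (toℕ i + k))      ≡⟨ lookup-rotate j v _ ⟩
      lookup v (idx (toℕ (idx (toℕ i + k)) + j)) ≡⟨ cong (lookup v) (trans (idx-+ (toℕ i + k) j) (cong idx (+-assoc (toℕ i) k j))) ⟩
      lookup v (idx (toℕ i + (k + j)))           ≡⟨ sym (lookup-rotate (k + j) v i) ⟩
      lookup (rotate (k + j) v) i                ∎)
    where open ≡-Reasoning

  rotate-0 : ∀ v → rotate 0 v ≡ v
  rotate-0 v = vec-ext (λ i → trans (lookup-rotate 0 v i) (cong (lookup v) (trans (cong idx (+-identityʳ (toℕ i))) (idx-toℕ i))))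

  undo : ℕ → ℕ
  undo a = n ∸ a % n

  +-undo : ∀ a → (a + undo a) % n ≡ 0 % n
  +-undo a = begin
      (a + (n ∸ a % n)) % n                 ≡⟨ cong (λ z → (z + (n ∸ a % n)) % n) (m≡m%n+[m/n]*n a n) ⟩
      (a % n + a / n * n + (n ∸ a % n)) % n ≡⟨ cong (_% n) (solve 3 (λ r k u → r :+ k :+ u := r :+ u :+ k) refl (a % n) (a / n * n) _) ⟩
      (a % n + (n ∸ a % n) + a / n * n) % n ≡⟨ cong (λ z → (z + a / n * n) % n) (m+[n∸m]≡n (m%n≤n a n)) ⟩
      (n + a / n * n) % n                   ≡⟨ [m+kn]%n≡m%n n (a / n) n ⟩
      n % n                                 ≡⟨ trans (n%n≡0 n) (sym (m<n⇒m%n≡m (>-nonZero⁻¹ n))) ⟩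
      0 % n                                 ∎
    where open ≡-Reasoning

  rotate-undo : ∀ a v → rotate (undo a) (rotate a v) ≡ v
  rotate-undo a v = trans (rotate-rotate a (undo a) v)
    (trans (rotate-cong v (trans (cong (_% n) (+-comm (undo a) a)) (+-undo a))) (rotate-0 v))

  rotate-rotate-< : ∀ a v x → ∃ λ y → y < n × rotate x (rotate a v) ≡ rotate y v
  rotate-rotate-< a v x = (x + a) % n , m%n<n (x + a) n ,
    trans (rotate-rotate a x v) (rotate-cong v (sym (m%n%n≡m%n (x + a) n)))

  code : W → ℕ
  code w = toℕ (from (wordCode q n) w)

  leastCode : W → ℕ
  leastCode w = minUpTo (pred n) (λ k → code (rotate k w))

  leastCode-≤ : ∀ v w → (∀ x → x < n → ∃ λ y → y < n × rotate x w ≡ rotate y v) → leastCode v ≤ leastCode w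
  leastCode-≤ v w covered with minUpTo-attained (pred n) (λ k → code (rotate k w))
  ... | x , x≤ , least≡ with covered x (m≤pred[n]⇒suc[m]≤n x≤)
  ...   | y , y<n , same = ≤-trans (minUpTo-≤ (pred n) _ (<⇒≤pred y<n)) (≤-reflexive (sym (trans least≡ (cong code same))))

  leastCode-rotate : ∀ a w → leastCode (rotate a w) ≡ leastCode w
  leastCode-rotate a w = ≤-antisym (leastCode-≤ (rotate a w) w back) (leastCode-≤ w (rotate a w) (λ x _ → rotate-rotate-< a w x))
    where
    back : ∀ x → x < n → ∃ λ y → y < n × rotate x w ≡ rotate y (rotate a w)
    back x _ with rotate-rotate-< (undo a) (rotate a w) x
    ... | y , y<n , eq = y , y<n , trans (cong (rotate x) (sym (rotate-undo a w))) eq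

  leastCode< : ∀ w → leastCode w < q ^ n
  leastCode< w with minUpTo-attained (pred n) (λ k → code (rotate k w))
  ... | x , _ , least≡ = subst (_< q ^ n) (sym least≡) (Fin.toℕ<n _)

  canonical : W → W
  canonical w = to (wordCode q n) (fromℕ< (leastCode< w))

  canonical-rotate : ∀ a w → canonical (rotate a w) ≡ canonical w
  canonical-rotate a w = cong (to (wordCode q n)) (Fin.toℕ-injective
    (trans (Fin.toℕ-fromℕ< _) (trans (leastCode-rotate a w) (sym (Fin.toℕ-fromℕ< _)))))

  canonical-is-rotation : ∀ w → ∃ λ x → canonical w ≡ rotate x w
  canonical-is-rotation w with minUpTo-attained (pred n) (λ k → code (rotate k w))
  ... | x , _ , least≡ = x , trans (cong (to (wordCode q n)) (Fin.toℕ-injective (trans (Fin.toℕ-fromℕ< _) least≡)))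
                                   (strictlyInverseˡ (wordCode q n) (rotate x w))

  canonical-idem : ∀ w → canonical (canonical w) ≡ canonical w
  canonical-idem w with canonical-is-rotation w
  ... | x , eq = trans (cong canonical eq) (canonical-rotate x w)

  rotation-of-canonical : ∀ w → ∃ λ y → w ≡ rotate y (canonical w)
  rotation-of-canonical w with canonical-is-rotation w
  ... | x , eq = undo x , trans (sym (rotate-undo x w)) (cong (rotate (undo x)) (sym eq))

  RotEquiv⇒canonical : ∀ v w → RotEquiv n q v w → canonical w ≡ canonical v
  RotEquiv⇒canonical v w re with RotEquiv⇒ v w re
  ... | k , w≡ = trans (cong canonical w≡) (canonical-rotate k v)

  canonical⇒RotEquiv : ∀ v w → canonical v ≡ canonical w → RotEquiv n q v w
  canonical⇒RotEquiv v w eq with rotation-of-canonical w | canonical-is-rotation v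
  ... | y , w≡ | x , v≡ = ⇒RotEquiv v w (y + x) (trans w≡ (trans (cong (rotate y) (trans (sym eq) v≡)) (rotate-rotate x y v)))

  -- A word fixed by rotation by t is exactly a word of period d = gcd(t, n),
  -- so there are q^d of them.
  module Fixed (t : ℕ) where

    d : ℕ
    d = gcd t n

    instance
      d≢0 : NonZero d
      d≢0 = ≢-nonZero (gcd[m,n]≢0 t n (inj₂ (λ n≡0 → <⇒≢ (>-nonZero⁻¹ n) (sym n≡0))))

    at : W → ℕ → Fin q
    at w x = lookup w (idx x)

    fixed-shift : ∀ w → rotate t w ≡ w → ∀ x k → at w x ≡ at w (x + k * t)
    fixed-shift w fixed x zero    = cong (at w) (sym (+-identityʳ x))
    fixed-shift w fixed x (suc k) = begin
        at w x                        ≡⟨ fixed-shift w fixed x k ⟩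
        at w (x + k * t)              ≡⟨ cong (λ u → lookup u (idx (x + k * t))) (sym fixed) ⟩
        lookup (rotate t w) (idx (x + k * t)) ≡⟨ lookup-rotate t w _ ⟩
        at w (toℕ (idx (x + k * t)) + t)      ≡⟨ cong (lookup w) (idx-+ (x + k * t) t) ⟩
        at w (x + k * t + t)          ≡⟨ cong (at w) (trans (+-assoc x _ t) (cong (x +_) (+-comm (k * t) t))) ⟩
        at w (x + (t + k * t))        ∎
      where open ≡-Reasoning

    -- Since a·t ≡ d (mod n) for some a, a t-fixed word has period d.
    fixed-periodic : ∀ w → rotate t w ≡ w → ∀ i → at w (i % d) ≡ at w i
    fixed-periodic w fixed i with bezout-mod t n
    ... | a , at≡d = trans (fixed-shift w fixed (i % d) (i / d * a)) (cong (lookup w) (idx-cong (begin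
          (i % d + i / d * a * t) % n ≡⟨ %-congʳ-+ (i % d) (trans (cong (_% n) (*-assoc (i / d) a t)) (%-congʳ-* (i / d) at≡d)) ⟩
          (i % d + i / d * d) % n     ≡⟨ cong (_% n) (sym (m≡m%n+[m/n]*n i d)) ⟩
          i % n                       ∎)))
      where open ≡-Reasoning

    modd : Fin n → Fin d
    modd i = fromℕ< (m%n<n (toℕ i) d)

    first : Fin d → Fin n
    first j = fromℕ< (<-≤-trans (Fin.toℕ<n j) (gcd[m,n]≤n t n))

    modd-rotate : ∀ i → modd (idx (toℕ i + t)) ≡ modd i
    modd-rotate i = Fin.toℕ-injective (begin
        toℕ (modd (idx (toℕ i + t))) ≡⟨ Fin.toℕ-fromℕ< _ ⟩
        toℕ (idx (toℕ i + t)) % d ≡⟨ cong (_% d) (toℕ-idx _) ⟩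
        (toℕ i + t) % n % d       ≡⟨ m∣n⇒o%n%m≡o%m d n (toℕ i + t) (gcd[m,n]∣n t n) ⟩
        (toℕ i + t) % d           ≡⟨ %-remove-+ʳ (toℕ i) (gcd[m,n]∣m t n) ⟩
        toℕ i % d                 ≡⟨ sym (Fin.toℕ-fromℕ< _) ⟩
        toℕ (modd i)              ∎)
      where open ≡-Reasoning

    extend : Word d q → W
    extend v = tabulate (lookup v ∘ modd)

    restrict : W → Word d q
    restrict w = tabulate (lookup w ∘ first)

    extend-fixed : ∀ v → rotate t (extend v) ≡ extend v
    extend-fixed v = vec-ext (λ i → trans (lookup-rotate t (extend v) i)
      (trans (lookup∘tabulate (lookup v ∘ modd) (idx (toℕ i + t))) (trans (cong (lookup v) (modd-rotate i)) (sym (lookup∘tabulate _ i)))))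

    restrict-extend : ∀ v → restrict (extend v) ≡ v
    restrict-extend v = vec-ext (λ j → trans (lookup∘tabulate _ j) (trans (lookup∘tabulate _ (first j))
      (cong (lookup v) (Fin.toℕ-injective (trans (Fin.toℕ-fromℕ< _)
        (trans (cong (_% d) (Fin.toℕ-fromℕ< _)) (m<n⇒m%n≡m (Fin.toℕ<n j))))))))

    extend-restrict : ∀ w → rotate t w ≡ w → extend (restrict w) ≡ w
    extend-restrict w fixed = vec-ext (λ i → begin
        lookup (extend (restrict w)) i  ≡⟨ lookup∘tabulate _ i ⟩
        lookup (restrict w) (modd i)    ≡⟨ lookup∘tabulate _ (modd i) ⟩
        lookup w (first (modd i))       ≡⟨ cong (lookup w) (Fin.toℕ-injective (trans (Fin.toℕ-fromℕ< _)
                                             (trans (Fin.toℕ-fromℕ< _) (sym (toℕ-idx-mod i))))) ⟩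
        at w (toℕ i % d)                ≡⟨ fixed-periodic w fixed (toℕ i) ⟩
        at w (toℕ i)                    ≡⟨ cong (lookup w) (idx-toℕ i) ⟩
        lookup w i                      ∎)
      where
      open ≡-Reasoning
      toℕ-idx-mod : ∀ i → toℕ (idx (toℕ i % d)) ≡ toℕ i % d
      toℕ-idx-mod i = trans (toℕ-idx _) (m<n⇒m%n≡m (<-≤-trans (m%n<n (toℕ i) d) (gcd[m,n]≤n t n)))

    fixed↔ : Σ W (λ w → rotate t w ≡ w) ↔ Word d q
    fixed↔ = mk↔ₛ′ (restrict ∘ proj₁) (λ v → extend v , extend-fixed v) restrict-extend
                   (λ { (w , fixed) → Σ-≡ (λ _ → uip) (extend-restrict w fixed) })

    fixed-count : countWords q n (λ w → rotate t w ≟W w) ≡ q ^ d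
    fixed-count = sym (countWords-unique q n (λ w → rotate t w ≟W w) (λ _ → uip) (↔-trans (wordCode q d) (↔-sym fixed↔)))

  sumBelow-translate : ∀ a (G : ℕ → ℕ) → sumBelow n G ≡ sumBelow n (λ t → G ((a + t) % n))
  sumBelow-translate a G = trans (∑-permute (G ∘ toℕ) π) (sum-cong-≗ {n} (λ i → cong G (toℕ-idx (a + toℕ i))))
    where
    back : ∀ b c (i : Fin n) → (b + c) % n ≡ 0 % n → idx (b + toℕ (idx (c + toℕ i))) ≡ i
    back b c i b+c≡0 = trans (idx-cong (trans (%-congʳ-+ b (trans (cong (_% n) (toℕ-idx _)) (m%n%n≡m%n _ n)))
      (trans (cong (_% n) (sym (+-assoc b c (toℕ i)))) (%-congˡ-+ (toℕ i) b+c≡0)))) (idx-toℕ i)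
    π : Fin n ↔ Fin n
    π = mk↔ₛ′ (λ i → idx (a + toℕ i)) (λ i → idx (undo a + toℕ i))
      (λ i → back a (undo a) i (+-undo a))
      (λ i → back (undo a) a i (trans (cong (_% n) (+-comm (undo a) a)) (+-undo a)))

  stabilizer : W → ℕ
  stabilizer w = sumBelow n (λ t → 𝟙 (rotate t w ≟W w))

  K : ℕ
  K = countWords q n (λ w → canonical w ≟W w)

  sum-stabilizers : sumWords q n stabilizer ≡ sumBelow n (λ t → q ^ gcd t n)
  sum-stabilizers = trans (sumWords-sumBelow q n n (λ t w → 𝟙 (rotate t w ≟W w)))
                          (sumBelow-cong n (λ t _ → Fixed.fixed-count t))

  -- Writing w = rotate y (canonical w), the rotations taking canonical w to w
  -- are the stabiliser of w translated by y.
  stabilizer-canonical : ∀ w → stabilizer w ≡ sumBelow n (λ u → 𝟙 (rotate u (canonical w) ≟W w))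
  stabilizer-canonical w with rotation-of-canonical w
  ... | y , w≡ = trans (sumBelow-cong n (λ t _ → 𝟙-cong (rotate t w ≟W w) (rotate ((y + t) % n) (canonical w) ≟W w)
                          (trans (sym (same t))) (trans (same t))))
                       (sym (sumBelow-translate y (λ u → 𝟙 (rotate u (canonical w) ≟W w))))
    where
    same : ∀ t → rotate t w ≡ rotate ((y + t) % n) (canonical w)
    same t = trans (cong (rotate t) w≡) (trans (rotate-rotate y t (canonical w))
      (rotate-cong (canonical w) (trans (cong (_% n) (+-comm t y)) (sym (m%n%n≡m%n (y + t) n)))))

  -- For each u, w ↦ canonical w is a bijection from the words with
  -- rotate u (canonical w) ≡ w onto the canonical words.
  rotated-canonical-count : ∀ u → countWords q n (λ w → rotate u (canonical w) ≟W w) ≡ K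
  rotated-canonical-count u = countWords-unique q n (λ w → canonical w ≟W w) (λ _ → uip)
    (↔-trans (enumerateWords q n (λ w → rotate u (canonical w) ≟W w) (λ _ → uip)) bij)
    where
    bij : Σ W (λ w → rotate u (canonical w) ≡ w) ↔ Σ W (λ c → canonical c ≡ c)
    bij = mk↔ₛ′ (λ (w , _) → canonical w , canonical-idem w)
                (λ (c , c≡) → rotate u c , cong (rotate u) (trans (canonical-rotate u c) c≡))
                (λ { (c , c≡) → Σ-≡ (λ _ → uip) (trans (canonical-rotate u c) c≡) })
                (λ { (w , w≡) → Σ-≡ (λ _ → uip) w≡ })

  burnside : n * K ≡ sumBelow n (λ t → q ^ gcd t n)
  burnside = begin
      n * K                                                              ≡⟨ sym (sum-const n K) ⟩
      sumBelow n (λ u → K)                                               ≡⟨ sumBelow-cong n (λ u _ → sym (rotated-canonical-count u)) ⟩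
      sumBelow n (λ u → sumWords q n (λ w → 𝟙 (rotate u (canonical w) ≟W w)))
        ≡⟨ sym (sumWords-sumBelow q n n (λ u w → 𝟙 (rotate u (canonical w) ≟W w))) ⟩
      sumWords q n (λ w → sumBelow n (λ u → 𝟙 (rotate u (canonical w) ≟W w))) ≡⟨ sym (sumWords-cong q n stabilizer-canonical) ⟩
      sumWords q n stabilizer                                            ≡⟨ sum-stabilizers ⟩
      sumBelow n (λ t → q ^ gcd t n)                                     ∎
    where open ≡-Reasoning

  canonical↔ : Fin K ↔ Σ W (λ c → canonical c ≡ c)
  canonical↔ = enumerateWords q n (λ w → canonical w ≟W w) (λ _ → uip)

  necklaceCount : IsNecklaceCount n q K
  necklaceCount = rep , distinct , complete
    where
    rep : Fin K → W
    rep a = proj₁ (to canonical↔ a)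
    distinct : ∀ a b → RotEquiv n q (rep a) (rep b) → a ≡ b
    distinct a b re = Injection.injective (↔⇒↣ canonical↔) (Σ-≡ (λ _ → uip)
      (trans (sym (proj₂ (to canonical↔ a))) (trans (sym (RotEquiv⇒canonical (rep a) (rep b) re)) (proj₂ (to canonical↔ b)))))
    complete : ∀ w → ∃ λ a → RotEquiv n q (rep a) w
    complete w = from canonical↔ (canonical w , canonical-idem w) ,
      canonical⇒RotEquiv (rep _) w (trans (cong (canonical ∘ proj₁) (strictlyInverseˡ canonical↔ _)) (canonical-idem w))

  -- Any complete system of pairwise inequivalent representatives has K elements:
  -- a ↦ canonical (reps a) is a bijection onto the canonical words.
  necklaceCount-unique : ∀ k → IsNecklaceCount n q k → k ≡ K
  necklaceCount-unique k (reps , distinct , complete) = ↔⇒≡ (↔-trans bij (↔-sym canonical↔))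
    where
    class : ∀ w → Fin k
    class w = proj₁ (complete w)
    canonical-class : ∀ w → canonical (reps (class w)) ≡ canonical w
    canonical-class w = sym (RotEquiv⇒canonical (reps (class w)) w (proj₂ (complete w)))
    bij : Fin k ↔ Σ W (λ c → canonical c ≡ c)
    bij = mk↔ₛ′ (λ a → canonical (reps a) , canonical-idem (reps a)) (class ∘ proj₁)
      (λ { (c , c≡) → Σ-≡ (λ _ → uip) (trans (canonical-class c) c≡) })
      (λ a → distinct (class (canonical (reps a))) a (canonical⇒RotEquiv (reps (class (canonical (reps a)))) (reps a)
               (trans (canonical-class (canonical (reps a))) (canonical-idem (reps a)))))

theorem1p1 : ∀ (q n : ℕ) → 0 < q → .{{_ : NonZero n}} → Coprime q n →
    ∀ (m : ℕ) (s : Fin m → Fin n) → CosetReps n q m s →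
    ∀ (ℓ : Fin m → ℕ) → (∀ (i : Fin m) → IsCosetLength n q (toℕ (s i)) (ℓ i)) →
    ((∃ λ (k : ℕ) → IsNecklaceCount n q k)
      × (∀ (k : ℕ) → IsNecklaceCount n q k → n * k ≡ nTimesRHS n q m s ℓ))
    × ((∃ λ (k : ℕ) → (Fin k ↔ FSet n q))
      × (∀ (k : ℕ) → (Fin k ↔ FSet n q) → n * k ≡ nTimesRHS n q m s ℓ))
theorem1p1 q n 0<q q⊥n m s reps ℓ len =
    ( (K , necklaceCount)
    , λ k count → begin
        n * k                          ≡⟨ cong (n *_) (necklaceCount-unique k count) ⟩
        n * K                          ≡⟨ burnside ⟩
        sumBelow n (λ t → q ^ gcd t n) ≡⟨ sym RHS-gcd-sum ⟩
        nTimesRHS n q m s ℓ            ∎ )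
  , ( (countWords q n isF? , enumerateWords q n isF? (λ _ → uip))
    , λ k bij → begin
        n * k                          ≡⟨ cong (n *_) (countWords-unique q n isF? (λ _ → uip) bij) ⟩
        n * countWords q n isF?        ≡⟨ F-count ⟩
        nTimesRHS n q m s ℓ            ∎ )
  where
  open ≡-Reasoning
  open Rotation n q
  open Cosets q n 0<q q⊥n m s reps ℓ len
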